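{- Let $G$ be a connected cubic graph. The following are equivalent: (1) $G$ is localizable; (2) every vertex of $G$ is contained in a strong clique; (3) $G$ is isomorphic to one of the graphs in $\{K_{3,3},K_4,\overline{C_6}\}\cup\{F_n\mid n\ge 2\}$.
   Context: All graphs are finite, simple and undirected. A graph is cubic if every vertex has degree $3$. A clique is strong if it intersects every maximal independent set; a graph is localizable if its vertex set can be partitioned into strong cliques. $\overline{C_6}$ is the complement of the $6$-cycle. For $n\ge 2$, $F_n$ is the graph with vertex set $\{x_i,x'_i,y_i,y'_i,z_i,z'_i : 1\le i\le n\}$ whose edges are: for each $i$, the triangles $x_iy_iz_i$ and $x'_iy'_iz'_i$ and the edges $y_iy'_i$, $z_iz'_i$; and for each $i$, the edge $x_ix'_{i+1}$, indices taken modulo $n$ (so the last one is $x_nx'_1$). -}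

module Defs where

open import Data.Sum using (_⊎_)
open import Data.Nat using (ℕ; _≤_; _<ᵇ_; zero; suc; _+_; _*_; _<_; _≡ᵇ_; _%_)
open import Data.Bool using (Bool; true; false; T; not; _∧_; _∨_; _xor_; if_then_else_)
open import Data.Fin using (Fin; toℕ; remQuot; zero; suc)
open import Data.List using (List; map; allFin)
open import Data.Nat.ListAction using (sum)
open import Data.Product using (Σ; _×_; _,_; ∃)
open import Data.Empty using (⊥)
open import Relation.Nullary using (¬_)
open import Relation.Binary.PropositionalEquality using (_≡_; _≢_)
open import Function.Bundles using (_↔_; Inverse)

record Graph : Set where
  field
    order : ℕ
    adj   : Fin order → Fin order → Bool
open Graph public

Adj : (G : Graph) → Fin (order G) → Fin (order G) → Set
Adj G u v = T (adj G u v)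

IsSimple : Graph → Set
IsSimple G = (∀ u v → adj G u v ≡ adj G v u) × (∀ v → adj G v v ≡ false)

degree : (G : Graph) → Fin (order G) → ℕ
degree G v = sum (map (λ u → if adj G v u then 1 else 0) (allFin (order G)))

Cubic : Graph → Set
Cubic G = ∀ v → degree G v ≡ 3

-- walks / connectivity (the empty graph is not connected)
data Reachable (G : Graph) : Fin (order G) → Fin (order G) → Set where
  here : ∀ {u} → Reachable G u u
  step : ∀ {u v w} → Adj G u v → Reachable G v w → Reachable G u w

Connected : Graph → Set
Connected G = (0 < order G) × (∀ u v → Reachable G u v)

VSet : Graph → Set
VSet G = Fin (order G) → Bool

_∈_ : ∀ {n} → Fin n → (Fin n → Bool) → Set
v ∈ S = T (S v)

IsClique : (G : Graph) → VSet G → Set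
IsClique G C = ∀ u v → u ∈ C → v ∈ C → u ≢ v → Adj G u v

IsIndependent : (G : Graph) → VSet G → Set
IsIndependent G S = ∀ u v → u ∈ S → v ∈ S → ¬ Adj G u v

IsMaximalIndependent : (G : Graph) → VSet G → Set
IsMaximalIndependent G S =
  IsIndependent G S ×
  (∀ v → ¬ (v ∈ S) → ∃ λ u → u ∈ S × Adj G v u)

IsStrongClique : (G : Graph) → VSet G → Set
IsStrongClique G C =
  IsClique G C ×
  (∀ S → IsMaximalIndependent G S → ∃ λ v → v ∈ C × v ∈ S)

-- localizable: V(G) can be partitioned into strong cliques.
-- A partition into k parts is given by a map part : V → Fin k assigning
-- each vertex its (unique) part; part i is the fibre over i.
fibre : (G : Graph) {k : ℕ} → (Fin (order G) → Fin k) → Fin k → VSet G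
fibre G part i v = toℕ (part v) ≡ᵇ toℕ i

Localizable : Graph → Set
Localizable G =
  Σ ℕ λ k → Σ (Fin (order G) → Fin k) λ part →
    ∀ i → IsStrongClique G (fibre G part i)

EveryVertexInStrongClique : Graph → Set
EveryVertexInStrongClique G =
  ∀ v → ∃ λ C → IsStrongClique G C × v ∈ C

_≅_ : Graph → Graph → Set
G ≅ H = Σ (Fin (order G) ↔ Fin (order H)) λ φ →
  ∀ u v → adj H (Inverse.to φ u) (Inverse.to φ v) ≡ adj G u v

_==_ : ∀ {n} → Fin n → Fin n → Bool
u == v = toℕ u ≡ᵇ toℕ v

symm : ∀ {n} → (Fin n → Fin n → Bool) → Fin n → Fin n → Bool
symm r u v = not (u == v) ∧ (r u v ∨ r v u)

K4 : Graph
K4 = record { order = 4 ; adj = symm (λ _ _ → true) }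

side : Fin 6 → Bool
side v = toℕ v <ᵇ 3

K33 : Graph
K33 = record { order = 6 ; adj = symm (λ u v → side u xor side v) }

c6edge : Fin 6 → Fin 6 → Bool
c6edge u v = ((toℕ u + 1) % 6) ≡ᵇ toℕ v

C6bar : Graph
C6bar = record { order = 6 ; adj = λ u v → not (u == v) ∧ not (symm c6edge u v) }

-- F_n: vertex (i , t) ∈ Fin n × Fin 6 encoded via remQuot, where
-- t = 0,1,2,3,4,5 stands for x_i, y_i, z_i, x'_i, y'_i, z'_i.
-- Local edges (within the same i): triangles x y z and x' y' z',
-- and y y', z z'.
localEdge : Fin 6 → Fin 6 → Bool
localEdge zero (suc zero) = true
localEdge zero (suc (suc zero)) = true
localEdge (suc zero) (suc (suc zero)) = true
localEdge (suc (suc (suc zero))) (suc (suc (suc (suc zero)))) = true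
localEdge (suc (suc (suc zero))) (suc (suc (suc (suc (suc zero))))) = true
localEdge (suc (suc (suc (suc zero)))) (suc (suc (suc (suc (suc zero))))) = true
localEdge (suc zero) (suc (suc (suc (suc zero)))) = true
localEdge (suc (suc zero)) (suc (suc (suc (suc (suc zero))))) = true
localEdge _ _ = false

-- successor modulo n (only used for n ≥ 1)
sucMod : ℕ → ℕ → ℕ
sucMod zero    i = 0
sucMod (suc m) i = (i + 1) % suc m

FRaw : (n : ℕ) → Fin (n * 6) → Fin (n * 6) → Bool
FRaw n u v with remQuot {n} 6 u | remQuot {n} 6 v
... | (i , a) | (j , b) =
  ((toℕ i ≡ᵇ toℕ j) ∧ localEdge a b)
  ∨ ((toℕ a ≡ᵇ 0) ∧ (toℕ b ≡ᵇ 3) ∧ (sucMod n (toℕ i) ≡ᵇ toℕ j))  -- x_i x'_{i+1}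

F : ℕ → Graph
F n = record { order = n * 6 ; adj = symm (FRaw n) }

InFamily : Graph → Set
InFamily G = (G ≅ K33) ⊎ ((G ≅ K4) ⊎ ((G ≅ C6bar) ⊎ (Σ ℕ λ n → 2 ≤ n × (G ≅ F n))))

{-# OPTIONS --safe #-}
module Submission where

-- A strong clique C through a vertex v of a connected cubic graph G is analysed locally.
-- If C contains the three neighbours of v then G ≅ K₄. If C is an edge v p, then every
-- other neighbour of v is adjacent to every other neighbour of p, and G ≅ K₃,₃. Otherwise
-- C is a triangle whose three outer neighbours span an edge. When every vertex lies in
-- such a strong triangle, the triangles pair up along rungs into blocks x y z x′ y′ z′
-- joined by the edges xᵢ x′ᵢ₊₁; following them gives an infinite ladder, which closes up
-- in the finite graph G into Fₙ, or into F₁ ≅ C̄₆. Conversely every graph of the family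
-- is partitioned into explicit strong cliques: a perfect matching of K₃,₃, the two
-- triangles of C̄₆, and the two triangles of each block of Fₙ.

open import Defs
open import Data.Bool using (Bool; true; false; T; not; _∧_; _∨_; if_then_else_)
open import Data.Bool.Properties using (T?)
open import Data.Empty using (⊥; ⊥-elim)
open import Data.Fin using (Fin; zero; suc; toℕ; fromℕ; fromℕ<; inject₁; combine; remQuot; #_)
open import Data.Fin.Properties
  using (_≟_; any?; pigeonhole; toℕ-fromℕ<; toℕ-fromℕ; toℕ-inject₁; toℕ<n; toℕ-injective;
         remQuot-combine; combine-remQuot; combine-injective)
open import Data.List using (List; []; _∷_; map; allFin; filter; length)
open import Data.List.Membership.Propositional using () renaming (_∈_ to _∈ˡ_)
open import Data.List.Membership.Propositional.Properties using (∈-filter⁺; ∈-filter⁻; ∈-allFin)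
open import Data.List.Relation.Unary.All using ([]; _∷_)
open import Data.List.Relation.Unary.AllPairs using ([]; _∷_)
open import Data.List.Relation.Unary.Any using (here; there)
import Data.List.Relation.Unary.Unique.Propositional as ListUnique
open import Data.List.Relation.Unary.Unique.Propositional.Properties using (allFin⁺; filter⁺)
open import Data.Nat using (ℕ; zero; suc; _+_; _*_; _<_; _≤_; z≤n; s≤s; s≤s⁻¹; _≡ᵇ_; _%_)
open import Data.Nat.DivMod using (m<n⇒m%n≡m; n%n≡0)
open import Data.Nat.ListAction using (sum)
import Data.Nat.Properties as ℕ
open import Data.Nat.Properties
  using (+-identityʳ; m≤m+n; ≤-refl; ≤-trans; <-trans; n<1+n; <-irrefl; m≤n+m; ≤∧≢⇒<; <-cmp;
         ≤-antisym; m≤n⇒m<n∨m≡n; _<?_; ≮⇒≥; ≤-<-trans)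
open import Data.Product using (Σ; _×_; _,_; ∃; proj₁; proj₂)
open import Data.Sum as Sum using (_⊎_; inj₁; inj₂; [_,_])
open import Data.Vec using (Vec; []; _∷_; lookup)
open import Data.Vec.Relation.Unary.All using ([]; _∷_)
open import Data.Vec.Relation.Unary.AllPairs using ([]; _∷_)
import Data.Vec.Relation.Unary.Unique.Propositional as VecUnique
open import Data.Vec.Relation.Unary.Unique.Propositional.Properties using (lookup-injective)
open import Function.Base using (_∘_)
open import Function.Bundles using (_⇔_; mk⇔; Equivalence; Inverse; mk↔ₛ′)
open import Relation.Binary.Definitions using (tri<; tri≈; tri>)
open import Relation.Binary.PropositionalEquality
  using (_≡_; _≢_; refl; sym; trans; cong; cong₂; subst; subst₂)
open import Relation.Nullary using (¬_; yes; no; Dec)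
open import Relation.Nullary.Decidable using (⌊_⌋; dec-false)

∨-introˡ : ∀ {a b} → T a → T (a ∨ b)
∨-introˡ {true} _ = _

∨-introʳ : ∀ {a} b → T b → T (a ∨ b)
∨-introʳ {true}  _ _ = _
∨-introʳ {false} _ t = t

∨-elim : ∀ {a b} → T (a ∨ b) → T a ⊎ T b
∨-elim {true}  _ = inj₁ _
∨-elim {false} t = inj₂ t

∧-intro : ∀ {a b} → T a → T b → T (a ∧ b)
∧-intro {true} {true} _ _ = _

∧-elimˡ : ∀ {a b} → T (a ∧ b) → T a
∧-elimˡ {true} _ = _

∧-elimʳ : ∀ {a b} → T (a ∧ b) → T b
∧-elimʳ {true} t = t

_⇒ᵇ_ : Bool → Bool → Bool
a ⇒ᵇ b = not a ∨ b

⇒ᵇ-elim : ∀ {a b} → T (a ⇒ᵇ b) → T a → T b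
⇒ᵇ-elim {true} t _ = t

_⇔ᵇ_ : Bool → Bool → Bool
a ⇔ᵇ b = (a ⇒ᵇ b) ∧ (b ⇒ᵇ a)

⇔ᵇ-elim : ∀ {a b} → T (a ⇔ᵇ b) → a ≡ b
⇔ᵇ-elim {true}  {true}  _ = refl
⇔ᵇ-elim {false} {false} _ = refl

T-ext : ∀ {a b} → (T a → T b) → (T b → T a) → a ≡ b
T-ext {true}  {true}  _ _ = refl
T-ext {true}  {false} f _ = ⊥-elim (f _)
T-ext {false} {true}  _ g = ⊥-elim (g _)
T-ext {false} {false} _ _ = refl

∀⊎ : ∀ {n} {P : Fin n → Set} {Q : Set} → (∀ v → P v ⊎ Q) → (∀ v → P v) ⊎ Q
∀⊎ {zero}      h = inj₁ λ ()
∀⊎ {suc n} {P} h with h zero | ∀⊎ {n} {λ v → P (suc v)} (λ v → h (suc v))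
... | inj₂ q | _       = inj₂ q
... | inj₁ _ | inj₂ q  = inj₂ q
... | inj₁ p | inj₁ ps = inj₁ λ { zero → p ; (suc v) → ps v }

decT : ∀ b → Dec (T b)
decT true  = yes _
decT false = no λ ()

allᵇ : ∀ n → (Fin n → Bool) → Bool
allᵇ zero    p = true
allᵇ (suc n) p = p zero ∧ allᵇ n (λ x → p (suc x))

allᵇ-elim : ∀ n p → T (allᵇ n p) → ∀ x → T (p x)
allᵇ-elim (suc n) p t zero    = ∧-elimˡ t
allᵇ-elim (suc n) p t (suc x) = allᵇ-elim n (λ y → p (suc y)) (∧-elimʳ {p zero} t) x

_≡?ᵇ_ : ∀ {n} → Fin n → Fin n → Bool
u ≡?ᵇ v = ⌊ u ≟ v ⌋

≡?ᵇ-sound : ∀ {n} {u v : Fin n} → T (u ≡?ᵇ v) → u ≡ v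
≡?ᵇ-sound {u = u} {v} t with u ≟ v
... | yes e = e

≡?ᵇ-refl : ∀ {n} (u : Fin n) → T (u ≡?ᵇ u)
≡?ᵇ-refl u with u ≟ u
... | yes _ = _
... | no u≢u = u≢u refl

≢⇒not≡?ᵇ : ∀ {n} {u v : Fin n} → u ≢ v → T (not (u ≡?ᵇ v))
≢⇒not≡?ᵇ {u = u} {v} u≢v with u ≟ v
... | yes e = u≢v e
... | no _  = _

⟦_,_,_⟧ : ∀ {n} → Fin n → Fin n → Fin n → Fin n → Bool
⟦ a , b , c ⟧ u = (u ≡?ᵇ a) ∨ ((u ≡?ᵇ b) ∨ (u ≡?ᵇ c))

⟦⟧-elim : ∀ {n} {a b c u : Fin n} → T (⟦ a , b , c ⟧ u) → u ≡ a ⊎ (u ≡ b ⊎ u ≡ c)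
⟦⟧-elim {a = a} {b} {c} {u} t with u ≟ a | u ≟ b | u ≟ c
... | yes e | _     | _     = inj₁ e
... | no _  | yes e | _     = inj₂ (inj₁ e)
... | no _  | no _  | yes e = inj₂ (inj₂ e)

⟦⟧-∋₁ : ∀ {n} (a b c : Fin n) → T (⟦ a , b , c ⟧ a)
⟦⟧-∋₁ a b c = ∨-introˡ (≡?ᵇ-refl a)

⟦⟧-∋₂ : ∀ {n} (a b c : Fin n) → T (⟦ a , b , c ⟧ b)
⟦⟧-∋₂ a b c = ∨-introʳ {b ≡?ᵇ a} _ (∨-introˡ (≡?ᵇ-refl b))

⟦⟧-∋₃ : ∀ {n} (a b c : Fin n) → T (⟦ a , b , c ⟧ c)
⟦⟧-∋₃ a b c = ∨-introʳ {c ≡?ᵇ a} _ (∨-introʳ {c ≡?ᵇ b} _ (≡?ᵇ-refl c))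

_∈₃_ : ∀ {a} {X : Set a} → X → X × X × X → Set a
w ∈₃ (p , q , r) = w ≡ p ⊎ (w ≡ q ⊎ w ≡ r)

record Nbhd {n : ℕ} (A : Fin n → Fin n → Set) (v p q r : Fin n) : Set where
  constructor mkNbhd
  field
    p≢q : p ≢ q
    p≢r : p ≢ r
    q≢r : q ≢ r
    ∼p  : A v p
    ∼q  : A v q
    ∼r  : A v r
    only : ∀ w → A v w → w ∈₃ (p , q , r)

module SimpleGraph (G : Graph) (simple : IsSimple G) where

  V : Set
  V = Fin (order G)

  A : V → V → Set
  A = Adj G

  A-sym : ∀ {u v} → A u v → A v u
  A-sym {u} {v} = subst T (proj₁ simple u v)

  A-irrefl : ∀ {v} → ¬ A v v
  A-irrefl {v} = subst T (proj₂ simple v)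

  A⇒≢ : ∀ {u v} → A u v → u ≢ v
  A⇒≢ a refl = A-irrefl a

  ≢⇐A : ∀ {u v} → A u v → v ≢ u
  ≢⇐A a e = A⇒≢ a (sym e)

  independent₃ : ∀ {x y z} → ¬ A x y → ¬ A x z → ¬ A y z → IsIndependent G ⟦ x , y , z ⟧
  independent₃ {x} {y} {z} ¬xy ¬xz ¬yz u w tu tw a
    with ⟦⟧-elim {a = x} {y} {z} {u} tu | ⟦⟧-elim {a = x} {y} {z} {w} tw
  ... | inj₁ refl        | inj₁ refl        = A-irrefl a
  ... | inj₁ refl        | inj₂ (inj₁ refl) = ¬xy a
  ... | inj₁ refl        | inj₂ (inj₂ refl) = ¬xz a
  ... | inj₂ (inj₁ refl) | inj₁ refl        = ¬xy (A-sym a)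
  ... | inj₂ (inj₁ refl) | inj₂ (inj₁ refl) = A-irrefl a
  ... | inj₂ (inj₁ refl) | inj₂ (inj₂ refl) = ¬yz a
  ... | inj₂ (inj₂ refl) | inj₁ refl        = ¬xz (A-sym a)
  ... | inj₂ (inj₂ refl) | inj₂ (inj₁ refl) = ¬yz (A-sym a)
  ... | inj₂ (inj₂ refl) | inj₂ (inj₂ refl) = A-irrefl a

  private
    HasNbrIn : VSet G → V → Set
    HasNbrIn S v = ∃ λ u → T (adj G v u ∧ S u)

    hasNbrIn? : ∀ S v → Dec (HasNbrIn S v)
    hasNbrIn? S v = any? λ u → T? (adj G v u ∧ S u)

    greedyStep : (S : VSet G) (v : V) → Dec (HasNbrIn S v) → VSet G
    greedyStep S v (yes _) = S
    greedyStep S v (no _)  = λ u → S u ∨ (u ≡?ᵇ v)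

    greedy : List V → VSet G → VSet G
    greedy []       S = S
    greedy (v ∷ vs) S = greedy vs (greedyStep S v (hasNbrIn? S v))

    Dominated : VSet G → V → Set
    Dominated S v = v ∈ S ⊎ ∃ λ u → u ∈ S × A v u

    greedy-⊇ : ∀ vs S u → u ∈ S → u ∈ greedy vs S
    greedy-⊇ []       S u t = t
    greedy-⊇ (v ∷ vs) S u t = greedy-⊇ vs _ u (keep (hasNbrIn? S v) t)
      where
        keep : ∀ d → u ∈ S → u ∈ greedyStep S v d
        keep (yes _) t = t
        keep (no _)  t = ∨-introˡ t

    greedyStep-independent : ∀ S v d → IsIndependent G S → IsIndependent G (greedyStep S v d)
    greedyStep-independent S v (yes _) ind = ind
    greedyStep-independent S v (no ¬nbr) ind x y tx ty a
      with ∨-elim {S x} tx | ∨-elim {S y} ty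
    ... | inj₁ sx | inj₁ sy = ind x y sx sy a
    ... | inj₁ sx | inj₂ ey with ≡?ᵇ-sound ey
    ...   | refl = ¬nbr (x , ∧-intro (A-sym a) sx)
    greedyStep-independent S v (no ¬nbr) ind x y tx ty a | inj₂ ex | inj₁ sy with ≡?ᵇ-sound ex
    ... | refl = ¬nbr (y , ∧-intro a sy)
    greedyStep-independent S v (no ¬nbr) ind x y tx ty a | inj₂ ex | inj₂ ey
      with ≡?ᵇ-sound ex | ≡?ᵇ-sound ey
    ... | refl | refl = A-irrefl a

    greedy-independent : ∀ vs S → IsIndependent G S → IsIndependent G (greedy vs S)
    greedy-independent []       S i = i
    greedy-independent (v ∷ vs) S i = greedy-independent vs _ (greedyStep-independent S v (hasNbrIn? S v) i)

    greedy-dominates : ∀ vs S v → v ∈ˡ vs → Dominated (greedy vs S) v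
    greedy-dominates (v ∷ vs) S v (here refl) = later vs (now (hasNbrIn? S v))
      where
        now : ∀ d → Dominated (greedyStep S v d) v
        now (yes (u , t)) = inj₂ (u , ∧-elimʳ {adj G v u} t , ∧-elimˡ t)
        now (no _)        = inj₁ (∨-introʳ {S v} (v ≡?ᵇ v) (≡?ᵇ-refl v))
        later : ∀ ws {S'} → Dominated S' v → Dominated (greedy ws S') v
        later ws (inj₁ t)           = inj₁ (greedy-⊇ ws _ v t)
        later ws (inj₂ (u , t , a)) = inj₂ (u , greedy-⊇ ws _ u t , a)
    greedy-dominates (x ∷ vs) S v (there i) = greedy-dominates vs _ v i

  extendToMaximalIndependent : (I : VSet G) → IsIndependent G I →
    Σ (VSet G) λ S → IsMaximalIndependent G S × (∀ v → v ∈ I → v ∈ S)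
  extendToMaximalIndependent I ind =
    greedy vs I , (greedy-independent vs I ind , maximal) , greedy-⊇ vs I
    where
      vs : List V
      vs = allFin (order G)
      maximal : ∀ v → ¬ v ∈ greedy vs I → ∃ λ u → u ∈ greedy vs I × A v u
      maximal v v∉ with greedy-dominates vs I v (∈-allFin v)
      ... | inj₁ v∈ = ⊥-elim (v∉ v∈)
      ... | inj₂ d  = d

  -- The maximal independent set extending I avoids C.
  dominated⇒¬strong : (C I : VSet G) → IsIndependent G I →
    (∀ c → c ∈ C → ∃ λ u → u ∈ I × A c u) →
    ¬ (∀ S → IsMaximalIndependent G S → ∃ λ v → v ∈ C × v ∈ S)
  dominated⇒¬strong C I ind dom strong with extendToMaximalIndependent I ind
  ... | S , (indS , maxS) , I⊆S with strong S (indS , maxS)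
  ... | v , v∈C , v∈S with dom v v∈C
  ... | u , u∈I , a = indS v u v∈S (I⊆S u u∈I) a

module CubicGraph (G : Graph) (simple : IsSimple G) (cubic : Cubic G) where
  open SimpleGraph G simple public

  nbhd : ∀ v → Σ V λ p → Σ V λ q → Σ V λ r → Nbhd A v p q r
  nbhd v = fromList L refl
             (trans (sym (count≡length (allFin (order G)))) (cubic v))
             (filter⁺ (λ u → T? (adj G v u)) {allFin (order G)} (allFin⁺ (order G)))
    where
      L : List V
      L = filter (λ u → T? (adj G v u)) (allFin (order G))

      count≡length : ∀ xs → sum (map (λ u → if adj G v u then 1 else 0) xs)
                             ≡ length (filter (λ u → T? (adj G v u)) xs)
      count≡length [] = refl
      count≡length (x ∷ xs) with adj G v x
      ... | true  = cong suc (count≡length xs)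
      ... | false = count≡length xs

      fromList : ∀ xs → xs ≡ L → length xs ≡ 3 → ListUnique.Unique xs →
                 Σ V λ p → Σ V λ q → Σ V λ r → Nbhd A v p q r
      fromList (p ∷ q ∷ r ∷ []) xs≡L _ ((p≢q ∷ p≢r ∷ []) ∷ (q≢r ∷ []) ∷ _) =
        p , q , r , mkNbhd p≢q p≢r q≢r (∈⇒A (here refl)) (∈⇒A (there (here refl)))
                      (∈⇒A (there (there (here refl)))) only
        where
          ∈⇒A : ∀ {w} → w ∈ˡ p ∷ q ∷ r ∷ [] → A v w
          ∈⇒A i = proj₂ (∈-filter⁻ (λ u → T? (adj G v u)) {xs = allFin (order G)} (subst (_ ∈ˡ_) xs≡L i))
          only : ∀ w → A v w → w ∈₃ (p , q , r)
          only w a with subst (w ∈ˡ_) (sym xs≡L) (∈-filter⁺ (λ u → T? (adj G v u)) (∈-allFin w) a)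
          ... | here e                 = inj₁ e
          ... | there (here e)         = inj₂ (inj₁ e)
          ... | there (there (here e)) = inj₂ (inj₂ e)

  swap₁₂ : ∀ {v p q r} → Nbhd A v p q r → Nbhd A v q p r
  swap₁₂ (mkNbhd p≢q p≢r q≢r ∼p ∼q ∼r only) =
    mkNbhd (λ e → p≢q (sym e)) q≢r p≢r ∼q ∼p ∼r
      (λ w a → [ (λ e → inj₂ (inj₁ e)) , [ inj₁ , (λ e → inj₂ (inj₂ e)) ] ] (only w a))

  swap₂₃ : ∀ {v p q r} → Nbhd A v p q r → Nbhd A v p r q
  swap₂₃ (mkNbhd p≢q p≢r q≢r ∼p ∼q ∼r only) =
    mkNbhd p≢r p≢q (λ e → q≢r (sym e)) ∼p ∼r ∼q
      (λ w a → [ inj₁ , [ (λ e → inj₂ (inj₂ e)) , (λ e → inj₂ (inj₁ e)) ] ] (only w a))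

  rotate : ∀ {v p q r} → Nbhd A v p q r → Nbhd A v q r p
  rotate n = swap₂₃ (swap₁₂ n)

  third-unique : ∀ {v p q r w} → Nbhd A v p q r → A v w → w ≢ p → w ≢ q → w ≡ r
  third-unique n a w≢p w≢q with Nbhd.only n _ a
  ... | inj₁ e        = ⊥-elim (w≢p e)
  ... | inj₂ (inj₁ e) = ⊥-elim (w≢q e)
  ... | inj₂ (inj₂ e) = e

  nbhdWith₂ : ∀ {v p q} → A v p → A v q → p ≢ q → Σ V λ r → Nbhd A v p q r
  nbhdWith₂ {v} {p} {q} ∼p ∼q p≢q with nbhd v
  ... | a , b , c , n with Nbhd.only n p ∼p | Nbhd.only n q ∼q
  ... | inj₁ refl        | inj₁ refl        = ⊥-elim (p≢q refl)
  ... | inj₁ refl        | inj₂ (inj₁ refl) = c , n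
  ... | inj₁ refl        | inj₂ (inj₂ refl) = b , swap₂₃ n
  ... | inj₂ (inj₁ refl) | inj₁ refl        = c , swap₁₂ n
  ... | inj₂ (inj₁ refl) | inj₂ (inj₁ refl) = ⊥-elim (p≢q refl)
  ... | inj₂ (inj₁ refl) | inj₂ (inj₂ refl) = a , rotate n
  ... | inj₂ (inj₂ refl) | inj₁ refl        = b , rotate (rotate n)
  ... | inj₂ (inj₂ refl) | inj₂ (inj₁ refl) = a , swap₂₃ (rotate (rotate n))
  ... | inj₂ (inj₂ refl) | inj₂ (inj₂ refl) = ⊥-elim (p≢q refl)

  nbhdWith₁ : ∀ {v w} → A v w → Σ V λ x → Σ V λ y → Nbhd A v w x y
  nbhdWith₁ {v} ∼w with nbhd v
  ... | _ , _ , _ , n with Nbhd.only n _ ∼w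
  ... | inj₁ refl        = _ , _ , n
  ... | inj₂ (inj₁ refl) = _ , _ , swap₁₂ n
  ... | inj₂ (inj₂ refl) = _ , _ , rotate (rotate n)

  nbhdOf : ∀ {v x y z} → A v x → A v y → A v z → x ≢ y → x ≢ z → y ≢ z → Nbhd A v x y z
  nbhdOf ∼x ∼y ∼z x≢y x≢z y≢z with nbhdWith₂ ∼x ∼y x≢y
  ... | w , n with third-unique n ∼z (λ e → x≢z (sym e)) (λ e → y≢z (sym e))
  ... | refl = n

  -- A triangle v a b whose three outer neighbours v′ a′ b′ span an edge;
  -- this is what strongness of {v, a, b} forces.
  record StrongTriangle (v a b : V) : Set where
    field
      ∼a  : A v a
      ∼b  : A v b
      a∼b : A a b
      outer-edge : ∀ {v′ a′ b′} → Nbhd A v a b v′ → Nbhd A a v b a′ → Nbhd A b v a b′ →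
                   A v′ a′ ⊎ (A v′ b′ ⊎ A a′ b′)

-- A maximal independent set missing c₁ and c₂ contains a neighbour of each;
-- they cannot both lie outside C, as P₁ is complete to P₂.
strong-criterion : (H : Graph) (C : VSet H) → IsClique H C →
  (c₁ c₂ : Fin (order H)) → c₁ ∈ C → c₂ ∈ C →
  (P₁ P₂ : Fin (order H) → Set) →
  (∀ w → Adj H c₁ w → w ∈ C ⊎ P₁ w) →
  (∀ w → Adj H c₂ w → w ∈ C ⊎ P₂ w) →
  (∀ x y → P₁ x → P₂ y → Adj H x y) →
  IsStrongClique H C
strong-criterion H C clique c₁ c₂ c₁∈C c₂∈C P₁ P₂ nbr₁ nbr₂ complete = clique , meets
  where
    meets : ∀ S → IsMaximalIndependent H S → ∃ λ v → v ∈ C × v ∈ S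
    meets S (ind , max) with decT (S c₁) | decT (S c₂)
    ... | yes c₁∈S | _          = c₁ , c₁∈C , c₁∈S
    ... | no _     | yes c₂∈S   = c₂ , c₂∈C , c₂∈S
    ... | no c₁∉S  | no c₂∉S with max c₁ c₁∉S | max c₂ c₂∉S
    ... | u₁ , u₁∈S , a₁ | u₂ , u₂∈S , a₂ with nbr₁ u₁ a₁ | nbr₂ u₂ a₂
    ... | inj₁ u₁∈C | _         = u₁ , u₁∈C , u₁∈S
    ... | inj₂ _    | inj₁ u₂∈C = u₂ , u₂∈C , u₂∈S
    ... | inj₂ p₁   | inj₂ p₂   = ⊥-elim (ind u₁ u₂ u₁∈S u₂∈S (complete u₁ u₂ p₁ p₂))

strong-by-computation : (H : Graph) (C P₁ P₂ : VSet H) (c₁ c₂ : Fin (order H)) →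
  T (C c₁ ∧ (C c₂ ∧
     (allᵇ (order H) (λ u → allᵇ (order H) (λ v → (C u ∧ (C v ∧ not (u ≡?ᵇ v))) ⇒ᵇ adj H u v)) ∧
     (allᵇ (order H) (λ w → adj H c₁ w ⇒ᵇ (C w ∨ P₁ w)) ∧
     (allᵇ (order H) (λ w → adj H c₂ w ⇒ᵇ (C w ∨ P₂ w)) ∧
      allᵇ (order H) (λ x → allᵇ (order H) (λ y → (P₁ x ∧ P₂ y) ⇒ᵇ adj H x y)))))))
    → IsStrongClique H C
strong-by-computation H C P₁ P₂ c₁ c₂ t =
  strong-criterion H C clique c₁ c₂ (∧-elimˡ t) (∧-elimˡ t₁) (λ w → T (P₁ w)) (λ w → T (P₂ w))
    (λ w a → ∨-elim (⇒ᵇ-elim (allᵇ-elim N _ t₃ w) a))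
    (λ w a → ∨-elim (⇒ᵇ-elim (allᵇ-elim N _ t₄ w) a))
    (λ x y p₁ p₂ → ⇒ᵇ-elim (allᵇ-elim N _ (allᵇ-elim N _ t₅ x) y) (∧-intro p₁ p₂))
  where
    N : ℕ
    N = order H
    t₁ = ∧-elimʳ {C c₁} t
    t₂ = ∧-elimʳ {C c₂} t₁
    t₃ = ∧-elimˡ (∧-elimʳ {allᵇ N _} t₂)
    t₄ = ∧-elimˡ (∧-elimʳ {allᵇ N _} (∧-elimʳ {allᵇ N _} t₂))
    t₅ = ∧-elimʳ {allᵇ N _} (∧-elimʳ {allᵇ N _} (∧-elimʳ {allᵇ N _} t₂))
    clique : IsClique H C
    clique u v u∈C v∈C u≢v =
      ⇒ᵇ-elim (allᵇ-elim N _ (allᵇ-elim N _ (∧-elimˡ t₂) u) v) (∧-intro u∈C (∧-intro v∈C (≢⇒not≡?ᵇ u≢v)))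

module _ {G H : Graph} (φ : G ≅ H) where
  private
    to : Fin (order G) → Fin (order H)
    to = Inverse.to (proj₁ φ)
    from : Fin (order H) → Fin (order G)
    from = Inverse.from (proj₁ φ)
    to∘from : ∀ y → to (from y) ≡ y
    to∘from = Inverse.strictlyInverseˡ (proj₁ φ)
    from∘to : ∀ x → from (to x) ≡ x
    from∘to = Inverse.strictlyInverseʳ (proj₁ φ)
    to-adj : ∀ u v → adj H (to u) (to v) ≡ adj G u v
    to-adj = proj₂ φ
    from-adj : ∀ x y → adj G (from x) (from y) ≡ adj H x y
    from-adj x y = trans (sym (to-adj (from x) (from y))) (cong₂ (adj H) (to∘from x) (to∘from y))
    to-injective : ∀ {x y} → to x ≡ to y → x ≡ y
    to-injective {x} {y} e = trans (sym (from∘to x)) (trans (cong from e) (from∘to y))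

  strongClique-pullback : ∀ C → IsStrongClique H C → IsStrongClique G (λ v → C (to v))
  strongClique-pullback C (clique , meets) = clique′ , meets′
    where
      clique′ : IsClique G (λ v → C (to v))
      clique′ u v u∈C v∈C u≢v =
        subst T (to-adj u v) (clique (to u) (to v) u∈C v∈C (λ e → u≢v (to-injective e)))
      meets′ : ∀ S → IsMaximalIndependent G S → ∃ λ v → T (C (to v)) × v ∈ S
      meets′ S (ind , max) with meets (λ x → S (from x)) (ind′ , max′)
        where
          ind′ : IsIndependent H (λ x → S (from x))
          ind′ x y x∈S y∈S a = ind (from x) (from y) x∈S y∈S (subst T (sym (from-adj x y)) a)
          max′ : ∀ v → ¬ T (S (from v)) → ∃ λ u → T (S (from u)) × Adj H v u
          max′ v v∉S with max (from v) v∉S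
          ... | u , u∈S , a =
            to u , subst (λ z → T (S z)) (sym (from∘to u)) u∈S ,
            subst (λ z → T (adj H z (to u))) (to∘from v) (subst T (sym (to-adj (from v) u)) a)
      ... | x , x∈C , x∈S = from x , subst (λ z → T (C z)) (sym (to∘from x)) x∈C , x∈S

  localizable-pullback : Localizable H → Localizable G
  localizable-pullback (k , part , strong) =
    k , (λ v → part (to v)) , λ i → strongClique-pullback (fibre H part i) (strong i)

≅-trans : ∀ {G H K} → G ≅ H → H ≅ K → G ≅ K
≅-trans (φ , φ-adj) (ψ , ψ-adj) =
  mk↔ₛ′ (λ v → Inverse.to ψ (Inverse.to φ v)) (λ w → Inverse.from φ (Inverse.from ψ w))
        (λ w → trans (cong (Inverse.to ψ) (Inverse.strictlyInverseˡ φ _)) (Inverse.strictlyInverseˡ ψ w))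
        (λ v → trans (cong (Inverse.from φ) (Inverse.strictlyInverseʳ ψ _)) (Inverse.strictlyInverseʳ φ v)) ,
  λ u v → trans (ψ-adj (Inverse.to φ u) (Inverse.to φ v)) (φ-adj u v)

localizable⇒everyVertexInStrongClique : ∀ G → Localizable G → EveryVertexInStrongClique G
localizable⇒everyVertexInStrongClique G (k , part , strong) v =
  fibre G part (part v) , strong (part v) , ≡⇒≡ᵇ-refl (toℕ (part v))
  where
    ≡⇒≡ᵇ-refl : ∀ n → T (n ≡ᵇ n)
    ≡⇒≡ᵇ-refl n = ℕ.≡⇒≡ᵇ n n refl

record NeighbourTable (H : Graph) : Set where
  field
    n₁ n₂ n₃ : Fin (order H) → Fin (order H)
    exact    : ∀ i j → Adj H i j ⇔ j ∈₃ (n₁ i , n₂ i , n₃ i)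

neighbourTable-by-computation : (H : Graph) (n₁ n₂ n₃ : Fin (order H) → Fin (order H)) →
  T (allᵇ (order H) λ i → allᵇ (order H) λ j → adj H i j ⇔ᵇ ⟦ n₁ i , n₂ i , n₃ i ⟧ j) →
  NeighbourTable H
neighbourTable-by-computation H n₁ n₂ n₃ t = record
  { n₁ = n₁ ; n₂ = n₂ ; n₃ = n₃
  ; exact = λ i j → mk⇔ (λ a → ⟦⟧-elim (subst T (row i j) a)) (λ m → subst T (sym (row i j)) (∋ m)) }
  where
    row : ∀ i j → adj H i j ≡ ⟦ n₁ i , n₂ i , n₃ i ⟧ j
    row i j = ⇔ᵇ-elim (allᵇ-elim _ _ (allᵇ-elim _ _ t i) j)
    ∋ : ∀ {i j} → j ∈₃ (n₁ i , n₂ i , n₃ i) → T (⟦ n₁ i , n₂ i , n₃ i ⟧ j)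
    ∋ {i} (inj₁ refl)        = ⟦⟧-∋₁ (n₁ i) (n₂ i) (n₃ i)
    ∋ {i} (inj₂ (inj₁ refl)) = ⟦⟧-∋₂ (n₁ i) (n₂ i) (n₃ i)
    ∋ {i} (inj₂ (inj₂ refl)) = ⟦⟧-∋₃ (n₁ i) (n₂ i) (n₃ i)

-- Connectedness of G makes f onto.
≅-from-neighbourhoods : (G H : Graph) → (∀ u v → Reachable G u v) →
  (table : NeighbourTable H) (f : Fin (order H) → Fin (order G)) →
  (∀ {i j} → f i ≡ f j → i ≡ j) →
  (let open NeighbourTable table in ∀ i → Nbhd (Adj G) (f i) (f (n₁ i)) (f (n₂ i)) (f (n₃ i))) →
  Fin (order H) → G ≅ H
≅-from-neighbourhoods G H connected table f f-injective nbhd i₀ =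
  mk↔ₛ′ g f (λ i → f-injective (f∘g (f i))) f∘g ,
  λ u v → trans (sym (f-adj (g u) (g v))) (cong₂ (adj G) (f∘g u) (f∘g v))
  where
    open NeighbourTable table

    f-adj : ∀ i j → adj G (f i) (f j) ≡ adj H i j
    f-adj i j = T-ext G⇒H H⇒G
      where
        G⇒H : Adj G (f i) (f j) → Adj H i j
        G⇒H a = Equivalence.from (exact i j)
                  (Sum.map f-injective (Sum.map f-injective f-injective) (Nbhd.only (nbhd i) (f j) a))
        H⇒G : Adj H i j → Adj G (f i) (f j)
        H⇒G a with Equivalence.to (exact i j) a
        ... | inj₁ refl        = Nbhd.∼p (nbhd i)
        ... | inj₂ (inj₁ refl) = Nbhd.∼q (nbhd i)
        ... | inj₂ (inj₂ refl) = Nbhd.∼r (nbhd i)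

    inImage : ∀ {u v} → Reachable G u v → (∃ λ j → f j ≡ u) → ∃ λ j → f j ≡ v
    inImage here         p          = p
    inImage (step a r) (j , refl) with Nbhd.only (nbhd j) _ a
    ... | inj₁ e        = inImage r (n₁ j , sym e)
    ... | inj₂ (inj₁ e) = inImage r (n₂ j , sym e)
    ... | inj₂ (inj₂ e) = inImage r (n₃ j , sym e)

    g : Fin (order G) → Fin (order H)
    g v = proj₁ (inImage (connected (f i₀) v) (i₀ , refl))

    f∘g : ∀ v → f (g v) ≡ v
    f∘g v = proj₂ (inImage (connected (f i₀) v) (i₀ , refl))

≅-by-computation : (G H : Graph) (to : Fin (order G) → Fin (order H)) (from : Fin (order H) → Fin (order G)) →
  T (allᵇ (order H) (λ y → to (from y) ≡?ᵇ y) ∧ (allᵇ (order G) (λ x → from (to x) ≡?ᵇ x) ∧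
     allᵇ (order G) (λ u → allᵇ (order G) (λ v → adj H (to u) (to v) ⇔ᵇ adj G u v)))) →
  G ≅ H
≅-by-computation G H to from t =
  mk↔ₛ′ to from (λ y → ≡?ᵇ-sound (allᵇ-elim _ _ (∧-elimˡ t) y))
                (λ x → ≡?ᵇ-sound (allᵇ-elim _ _ (∧-elimˡ t₁) x)) ,
  λ u v → ⇔ᵇ-elim (allᵇ-elim _ _ (allᵇ-elim _ _ (∧-elimʳ {allᵇ (order G) _} t₁) u) v)
  where t₁ = ∧-elimʳ {allᵇ (order H) _} t

K4-table : NeighbourTable K4
K4-table = neighbourTable-by-computation K4
  (lookup (# 1 ∷ # 0 ∷ # 0 ∷ # 0 ∷ []))
  (lookup (# 2 ∷ # 2 ∷ # 1 ∷ # 1 ∷ []))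
  (lookup (# 3 ∷ # 3 ∷ # 3 ∷ # 2 ∷ [])) _

K33-table : NeighbourTable K33
K33-table = neighbourTable-by-computation K33
  (lookup (# 3 ∷ # 3 ∷ # 3 ∷ # 0 ∷ # 0 ∷ # 0 ∷ []))
  (lookup (# 4 ∷ # 4 ∷ # 4 ∷ # 1 ∷ # 1 ∷ # 1 ∷ []))
  (lookup (# 5 ∷ # 5 ∷ # 5 ∷ # 2 ∷ # 2 ∷ # 2 ∷ [])) _

localizable-K4 : Localizable K4
localizable-K4 = 1 , (λ _ → zero) , λ
  { zero → strong-by-computation K4 _ (λ _ → false) (λ _ → false) zero zero _ }

localizable-K33 : Localizable K33
localizable-K33 = 3 , lookup (# 0 ∷ # 1 ∷ # 2 ∷ # 0 ∷ # 1 ∷ # 2 ∷ []) , λ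
  { zero             → strong-by-computation K33 _ ⟦ # 4 , # 5 , # 5 ⟧ ⟦ # 1 , # 2 , # 2 ⟧ (# 0) (# 3) _
  ; (suc zero)       → strong-by-computation K33 _ ⟦ # 3 , # 5 , # 5 ⟧ ⟦ # 0 , # 2 , # 2 ⟧ (# 1) (# 4) _
  ; (suc (suc zero)) → strong-by-computation K33 _ ⟦ # 3 , # 4 , # 4 ⟧ ⟦ # 0 , # 1 , # 1 ⟧ (# 2) (# 5) _ }

localizable-C6bar : Localizable C6bar
localizable-C6bar = 2 , lookup (# 0 ∷ # 1 ∷ # 0 ∷ # 1 ∷ # 0 ∷ # 1 ∷ []) , λ
  { zero       → strong-by-computation C6bar _ (_≡?ᵇ (# 3)) (_≡?ᵇ (# 5)) (# 0) (# 2) _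
  ; (suc zero) → strong-by-computation C6bar _ (_≡?ᵇ (# 4)) (_≡?ᵇ (# 0)) (# 1) (# 3) _ }

F1≅C6bar : F 1 ≅ C6bar
F1≅C6bar = ≅-by-computation (F 1) C6bar
  (lookup (# 0 ∷ # 2 ∷ # 4 ∷ # 3 ∷ # 5 ∷ # 1 ∷ []))
  (lookup (# 0 ∷ # 5 ∷ # 1 ∷ # 3 ∷ # 2 ∷ # 4 ∷ [])) _

pattern X  = zero
pattern Y  = suc zero
pattern Z  = suc (suc zero)
pattern X′ = suc (suc (suc zero))
pattern Y′ = suc (suc (suc (suc zero)))
pattern Z′ = suc (suc (suc (suc (suc zero))))

module FGraph (k : ℕ) where

  n : ℕ
  n = suc k

  sucF : Fin n → Fin n
  sucF i with suc (toℕ i) ℕ.<? n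
  ... | yes lt = fromℕ< lt
  ... | no _   = zero

  sucF-cases : ∀ i → toℕ (sucF i) ≡ suc (toℕ i) ⊎ (toℕ i ≡ k × sucF i ≡ zero)
  sucF-cases i with suc (toℕ i) ℕ.<? n
  ... | yes lt = inj₁ (toℕ-fromℕ< lt)
  ... | no ¬lt = inj₂ (≤-antisym (s≤s⁻¹ (toℕ<n i)) (s≤s⁻¹ (≮⇒≥ ¬lt)) , refl)

  toℕ-sucF : ∀ i → toℕ (sucF i) ≡ sucMod n (toℕ i)
  toℕ-sucF i with sucF-cases i
  ... | inj₁ e = trans e (trans (ℕ.+-comm 1 (toℕ i)) (sym (m<n⇒m%n≡m (subst (_< n) (ℕ.+-comm 1 (toℕ i)) lt))))
    where
      lt : suc (toℕ i) < n
      lt = subst (_< n) e (toℕ<n (sucF i))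
  ... | inj₂ (e , e′) =
    trans (cong toℕ e′) (trans (sym (n%n≡0 n)) (cong (_% n) (trans (ℕ.+-comm 1 k) (cong (_+ 1) (sym e)))))

  predF : Fin n → Fin n
  predF zero    = fromℕ k
  predF (suc j) = inject₁ j

  predF-sucF : ∀ i → predF (sucF i) ≡ i
  predF-sucF i with sucF-cases i
  ... | inj₂ (e , e′) rewrite e′ = toℕ-injective (trans (toℕ-fromℕ k) (sym e))
  ... | inj₁ e = lemma (sucF i) e
    where
      lemma : ∀ j → toℕ j ≡ suc (toℕ i) → predF j ≡ i
      lemma (suc j) e′ = toℕ-injective (trans (toℕ-inject₁ j) (ℕ.suc-injective e′))

  sucF-predF : ∀ i → sucF (predF i) ≡ i
  sucF-predF zero with sucF-cases (fromℕ k)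
  ... | inj₂ (_ , e′) = e′
  ... | inj₁ e = ⊥-elim (<-irrefl refl (subst (_< n) (trans e (cong suc (toℕ-fromℕ k))) (toℕ<n (sucF (fromℕ k)))))
  sucF-predF (suc j) with sucF-cases (inject₁ j)
  ... | inj₁ e       = toℕ-injective (trans e (cong suc (toℕ-inject₁ j)))
  ... | inj₂ (e , _) = ⊥-elim (<-irrefl (trans (sym (toℕ-inject₁ j)) e) (toℕ<n j))

  edge : Fin n → Fin 6 → Fin n → Fin 6 → Bool
  edge i a j b = ((toℕ i ≡ᵇ toℕ j) ∧ localEdge a b) ∨ ((toℕ a ≡ᵇ 0) ∧ ((toℕ b ≡ᵇ 3) ∧ (sucMod n (toℕ i) ≡ᵇ toℕ j)))

  FRaw-combine : ∀ i a j b → FRaw n (combine i a) (combine j b) ≡ edge i a j b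
  FRaw-combine i a j b = trans (unfold (combine i a) (combine j b))
    (cong₂ (λ p q → edge (proj₁ p) (proj₂ p) (proj₁ q) (proj₂ q)) (remQuot-combine i a) (remQuot-combine j b))
    where
      unfold : ∀ u v → FRaw n u v ≡ edge (proj₁ (remQuot {n} 6 u)) (proj₂ (remQuot {n} 6 u))
                                         (proj₁ (remQuot {n} 6 v)) (proj₂ (remQuot {n} 6 v))
      unfold u v with remQuot {n} 6 u | remQuot {n} 6 v
      ... | _ | _ = refl

  -- The neighbours of position t of block i are (i , m₁ t), (i , m₂ t) and
  -- (shift t i , m₃ t); only x and x′ have a neighbour in another block.
  m₁ m₂ m₃ : Fin 6 → Fin 6
  m₁ = lookup (Y ∷ Y′ ∷ Z′ ∷ Y′ ∷ X′ ∷ X′ ∷ [])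
  m₂ = lookup (Z ∷ Z  ∷ Y  ∷ Z′ ∷ Z′ ∷ Y′ ∷ [])
  m₃ = lookup (X′ ∷ X ∷ X  ∷ X  ∷ Y  ∷ Z  ∷ [])

  shift : Fin 6 → Fin n → Fin n
  shift X  = sucF
  shift X′ = predF
  shift _  = λ i → i

  inner : Fin 6 → Bool
  inner X  = false
  inner X′ = false
  inner _  = true

  M₁ M₂ M₃ : Fin n → Fin 6 → Fin n × Fin 6
  M₁ i t = i , m₁ t
  M₂ i t = i , m₂ t
  M₃ i t = shift t i , m₃ t

  Nbr : Fin n → Fin 6 → Fin n → Fin 6 → Set
  Nbr i t j s = (j , s) ∈₃ (M₁ i t , M₂ i t , M₃ i t)

  localNbrᵇ : Fin 6 → Fin 6 → Bool
  localNbrᵇ t s = (s ≡?ᵇ m₁ t) ∨ ((s ≡?ᵇ m₂ t) ∨ (inner t ∧ (s ≡?ᵇ m₃ t)))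

  localEdge≡localNbr : ∀ t s → localEdge t s ∨ localEdge s t ≡ localNbrᵇ t s
  localEdge≡localNbr t s = ⇔ᵇ-elim (allᵇ-elim 6 (entry t) (allᵇ-elim 6 (λ t → allᵇ 6 (entry t)) check t) s)
    where
      entry : Fin 6 → Fin 6 → Bool
      entry t s = (localEdge t s ∨ localEdge s t) ⇔ᵇ localNbrᵇ t s
      check : T (allᵇ 6 λ t → allᵇ 6 (entry t))
      check = _

  localNbr⇒Nbr : ∀ i t s → T (localNbrᵇ t s) → Nbr i t i s
  localNbr⇒Nbr i t s h with ∨-elim h
  ... | inj₁ e = inj₁ (cong (i ,_) (≡?ᵇ-sound e))
  ... | inj₂ h′ with ∨-elim h′
  ...   | inj₁ e  = inj₂ (inj₁ (cong (i ,_) (≡?ᵇ-sound e)))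
  ...   | inj₂ h″ = inj₂ (inj₂ (viaM₃ t (∧-elimˡ h″) (≡?ᵇ-sound (∧-elimʳ {inner t} h″))))
    where
      viaM₃ : ∀ t → T (inner t) → s ≡ m₃ t → (i , s) ≡ M₃ i t
      viaM₃ Y  _ refl = refl
      viaM₃ Z  _ refl = refl
      viaM₃ Y′ _ refl = refl
      viaM₃ Z′ _ refl = refl

  Nbr-irreflexive : ∀ i t → ¬ Nbr i t i t
  Nbr-irreflexive i t m = not-self t (⟦⟧-from (Sum.map (cong proj₂) (Sum.map (cong proj₂) (cong proj₂)) m))
    where
      ⟦⟧-from : ∀ {a b c u : Fin 6} → u ∈₃ (a , b , c) → T (⟦ a , b , c ⟧ u)
      ⟦⟧-from {a} {b} {c} (inj₁ refl)        = ⟦⟧-∋₁ a b c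
      ⟦⟧-from {a} {b} {c} (inj₂ (inj₁ refl)) = ⟦⟧-∋₂ a b c
      ⟦⟧-from {a} {b} {c} (inj₂ (inj₂ refl)) = ⟦⟧-∋₃ a b c
      not-self : ∀ t → ¬ T (⟦ m₁ t , m₂ t , m₃ t ⟧ t)
      not-self X  ()
      not-self Y  ()
      not-self Z  ()
      not-self X′ ()
      not-self Y′ ()
      not-self Z′ ()

  edge⇒Nbr : ∀ {i t j s} → T (edge i t j s) → Nbr i t j s
  edge⇒Nbr {i} {t} {j} {s} h with ∨-elim {(toℕ i ≡ᵇ toℕ j) ∧ localEdge t s} h
  ... | inj₁ h₁ with toℕ-injective {i = i} {j} (ℕ.≡ᵇ⇒≡ _ _ (∧-elimˡ h₁))
  ...   | refl = localNbr⇒Nbr i t s (subst T (localEdge≡localNbr t s) (∨-introˡ (∧-elimʳ {toℕ i ≡ᵇ toℕ i} h₁)))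
  edge⇒Nbr {i} {X} {j} {X′} h | inj₂ h₂ =
    inj₂ (inj₂ (cong (_, X′) (toℕ-injective (trans (sym (ℕ.≡ᵇ⇒≡ _ _ (∧-elimʳ {true} (∧-elimʳ {true} h₂)))) (sym (toℕ-sucF i))))))

  edge⇒Nbrᵒ : ∀ {i t j s} → T (edge j s i t) → Nbr i t j s
  edge⇒Nbrᵒ {i} {t} {j} {s} h with ∨-elim {(toℕ j ≡ᵇ toℕ i) ∧ localEdge s t} h
  ... | inj₁ h₁ with toℕ-injective {i = j} {i} (ℕ.≡ᵇ⇒≡ _ _ (∧-elimˡ h₁))
  ...   | refl = localNbr⇒Nbr i t s (subst T (localEdge≡localNbr t s) (∨-introʳ {localEdge t s} _ (∧-elimʳ {toℕ i ≡ᵇ toℕ i} h₁)))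
  edge⇒Nbrᵒ {i} {X′} {j} {X} h | inj₂ h₂ =
    inj₂ (inj₂ (cong (_, X) (trans (sym (predF-sucF j))
      (cong predF (toℕ-injective (trans (toℕ-sucF j) (ℕ.≡ᵇ⇒≡ _ _ (∧-elimʳ {true} (∧-elimʳ {true} h₂)))))))))

  local⇒edge : ∀ i t s → T (localNbrᵇ t s) → T (edge i t i s ∨ edge i s i t)
  local⇒edge i t s h with ∨-elim (subst T (sym (localEdge≡localNbr t s)) h)
  ... | inj₁ ts = ∨-introˡ (∨-introˡ (∧-intro (ℕ.≡⇒≡ᵇ (toℕ i) _ refl) ts))
  ... | inj₂ st = ∨-introʳ {edge i t i s} _ (∨-introˡ (∧-intro (ℕ.≡⇒≡ᵇ (toℕ i) _ refl) st))

  cross⇒edge : ∀ {i j} → sucMod n (toℕ i) ≡ toℕ j → T (edge i X j X′)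
  cross⇒edge {i} {j} e = ∨-introʳ {(toℕ i ≡ᵇ toℕ j) ∧ false} _ (ℕ.≡⇒≡ᵇ _ _ e)

  Nbr⇒edge : ∀ {i t j s} → Nbr i t j s → T (edge i t j s ∨ edge j s i t)
  Nbr⇒edge {i} {t} (inj₁ refl)        = local⇒edge i t (m₁ t) (∨-introˡ (≡?ᵇ-refl (m₁ t)))
  Nbr⇒edge {i} {t} (inj₂ (inj₁ refl)) =
    local⇒edge i t (m₂ t) (∨-introʳ {m₂ t ≡?ᵇ m₁ t} _ (∨-introˡ (≡?ᵇ-refl (m₂ t))))
  Nbr⇒edge {i} {X}  (inj₂ (inj₂ refl)) = ∨-introˡ (cross⇒edge {i} {sucF i} (sym (toℕ-sucF i)))
  Nbr⇒edge {i} {X′} (inj₂ (inj₂ refl)) =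
    ∨-introʳ {edge i X′ (predF i) X} _ (cross⇒edge {predF i} {i} (trans (sym (toℕ-sucF (predF i))) (cong toℕ (sucF-predF i))))
  Nbr⇒edge {i} {Y}  (inj₂ (inj₂ refl)) = local⇒edge i Y  X _
  Nbr⇒edge {i} {Z}  (inj₂ (inj₂ refl)) = local⇒edge i Z  X _
  Nbr⇒edge {i} {Y′} (inj₂ (inj₂ refl)) = local⇒edge i Y′ Y _
  Nbr⇒edge {i} {Z′} (inj₂ (inj₂ refl)) = local⇒edge i Z′ Z _

  adj-combine : ∀ i t j s → adj (F n) (combine i t) (combine j s) ≡ edge i t j s ∨ edge j s i t
  adj-combine i t j s rewrite FRaw-combine i t j s | FRaw-combine j s i t = distinct-∧ distinct
    where
      distinct-∧ : ∀ {b c} → (T c → T (not b)) → not b ∧ c ≡ c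
      distinct-∧ {true}  {true}  h = ⊥-elim (h _)
      distinct-∧ {true}  {false} _ = refl
      distinct-∧ {false}         _ = refl
      distinct : T (edge i t j s ∨ edge j s i t) → T (not (combine i t == combine j s))
      distinct h with toℕ (combine i t) ℕ.≟ toℕ (combine j s)
      ... | no ne = subst (λ b → T (not b)) (sym (dec-false (_ ℕ.≟ _) ne)) _
      ... | yes e with combine-injective i t j s (toℕ-injective e)
      ...   | refl , refl with ∨-elim {edge i t i t} h
      ...     | inj₁ h′ = ⊥-elim (Nbr-irreflexive i t (edge⇒Nbr h′))
      ...     | inj₂ h′ = ⊥-elim (Nbr-irreflexive i t (edge⇒Nbr h′))

  adj⇔Nbr : ∀ i t j s → Adj (F n) (combine i t) (combine j s) ⇔ Nbr i t j s
  adj⇔Nbr i t j s = mk⇔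
    (λ h → [ edge⇒Nbr {i} {t} {j} {s} , edge⇒Nbrᵒ {i} {t} {j} {s} ] (∨-elim {edge i t j s} (subst T (adj-combine i t j s) h)))
    (λ m → subst T (sym (adj-combine i t j s)) (Nbr⇒edge m))

  block : Fin (n * 6) → Fin n × Fin 6
  block = remQuot {n} 6

  combine-block : ∀ u → combine (proj₁ (block u)) (proj₂ (block u)) ≡ u
  combine-block = combine-remQuot {n} 6

  nbrOf : ∀ i t v → Adj (F n) (combine i t) v →
          Σ (Fin n) λ j → Σ (Fin 6) λ s → v ≡ combine j s × Nbr i t j s
  nbrOf i t v a =
    proj₁ (block v) , proj₂ (block v) , sym (combine-block v) ,
    Equivalence.to (adj⇔Nbr i t _ _) (subst (Adj (F n) (combine i t)) (sym (combine-block v)) a)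

  neighbourTable : NeighbourTable (F n)
  neighbourTable = record { n₁ = nbr M₁ ; n₂ = nbr M₂ ; n₃ = nbr M₃ ; exact = exact }
    where
      nbr : (Fin n → Fin 6 → Fin n × Fin 6) → Fin (n * 6) → Fin (n * 6)
      nbr M u = combine (proj₁ (M (proj₁ (block u)) (proj₂ (block u))))
                        (proj₂ (M (proj₁ (block u)) (proj₂ (block u))))
      exact : ∀ u v → Adj (F n) u v ⇔ v ∈₃ (nbr M₁ u , nbr M₂ u , nbr M₃ u)
      exact u v = mk⇔ to from
        where
          i : Fin n
          i = proj₁ (block u)
          t : Fin 6
          t = proj₂ (block u)
          mk : Fin n × Fin 6 → Fin (n * 6)
          mk p = combine (proj₁ p) (proj₂ p)
          to : Adj (F n) u v → v ∈₃ (nbr M₁ u , nbr M₂ u , nbr M₃ u)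
          to a with nbrOf i t v (subst (λ w → Adj (F n) w v) (sym (combine-block u)) a)
          ... | j , s , refl , m = Sum.map (cong mk) (Sum.map (cong mk) (cong mk)) m
          adjacent : ∀ j s → Nbr i t j s → Adj (F n) u (combine j s)
          adjacent j s m = subst (λ x → Adj (F n) x (combine j s)) (combine-block u) (Equivalence.from (adj⇔Nbr i t j s) m)
          from : v ∈₃ (nbr M₁ u , nbr M₂ u , nbr M₃ u) → Adj (F n) u v
          from (inj₁ refl)        = adjacent _ _ (inj₁ refl)
          from (inj₂ (inj₁ refl)) = adjacent _ _ (inj₂ (inj₁ refl))
          from (inj₂ (inj₂ refl)) = adjacent _ _ (inj₂ (inj₂ refl))

  triangle : Fin 6 → Fin 2
  triangle = lookup (# 0 ∷ # 0 ∷ # 0 ∷ # 1 ∷ # 1 ∷ # 1 ∷ [])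

  part : Fin (n * 6) → Fin (n * 2)
  part u = combine (proj₁ (block u)) (triangle (proj₂ (block u)))

  Triangle : Fin n → Fin 2 → VSet (F n)
  Triangle i e = fibre (F n) part (combine i e)

  ∈Triangle : ∀ i t → combine i t ∈ Triangle i (triangle t)
  ∈Triangle i t = subst (λ p → T (toℕ (combine (proj₁ p) (triangle (proj₂ p))) ≡ᵇ toℕ (combine i (triangle t))))
                        (sym (remQuot-combine i t)) (ℕ.≡⇒≡ᵇ (toℕ (combine i (triangle t))) _ refl)

  Triangle⇒ : ∀ i e w → w ∈ Triangle i e → Σ (Fin 6) λ t → w ≡ combine i t × triangle t ≡ e
  Triangle⇒ i e w h
    with combine-injective (proj₁ (block w)) (triangle (proj₂ (block w))) i e (toℕ-injective (ℕ.≡ᵇ⇒≡ _ _ h))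
  ... | refl , e≡ = proj₂ (block w) , sym (combine-block w) , e≡

  sameTriangle⇒Nbr : ∀ i t s → triangle t ≡ triangle s → t ≢ s → Nbr i t i s
  sameTriangle⇒Nbr i t s same t≢s = localNbr⇒Nbr i t s
    (⇒ᵇ-elim (allᵇ-elim 6 (entry t) (allᵇ-elim 6 (λ t → allᵇ 6 (entry t)) check t) s)
             (∧-intro (subst (λ e → T (e ≡?ᵇ triangle s)) (sym same) (≡?ᵇ-refl _)) (≢⇒not≡?ᵇ t≢s)))
    where
      entry : Fin 6 → Fin 6 → Bool
      entry t s = ((triangle t ≡?ᵇ triangle s) ∧ not (t ≡?ᵇ s)) ⇒ᵇ localNbrᵇ t s
      check : T (allᵇ 6 λ t → allᵇ 6 (entry t))
      check = _

  Triangle-clique : ∀ i e → IsClique (F n) (Triangle i e)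
  Triangle-clique i e v w v∈ w∈ v≢w with Triangle⇒ i e v v∈ | Triangle⇒ i e w w∈
  ... | t , refl , refl | s , refl , same =
    Equivalence.from (adj⇔Nbr i t i s) (sameTriangle⇒Nbr i t s (sym same) λ { refl → v≢w refl })

  -- Each triangle is strong through the rungs y y′ and z z′.
  Triangle-strong : ∀ i e → IsStrongClique (F n) (Triangle i e)
  Triangle-strong i zero =
    strong-criterion (F n) _ (Triangle-clique i zero) (combine i Y) (combine i Z)
      (∈Triangle i Y) (∈Triangle i Z) (_≡ combine i Y′) (_≡ combine i Z′) nbrY nbrZ
      (λ { _ _ refl refl → Equivalence.from (adj⇔Nbr i Y′ i Z′) (inj₂ (inj₁ refl)) })
    where
      nbrY : ∀ w → Adj (F n) (combine i Y) w → w ∈ Triangle i zero ⊎ w ≡ combine i Y′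
      nbrY w a with nbrOf i Y w a
      ... | _ , _ , refl , inj₁ refl        = inj₂ refl
      ... | _ , _ , refl , inj₂ (inj₁ refl) = inj₁ (∈Triangle i Z)
      ... | _ , _ , refl , inj₂ (inj₂ refl) = inj₁ (∈Triangle i X)
      nbrZ : ∀ w → Adj (F n) (combine i Z) w → w ∈ Triangle i zero ⊎ w ≡ combine i Z′
      nbrZ w a with nbrOf i Z w a
      ... | _ , _ , refl , inj₁ refl        = inj₂ refl
      ... | _ , _ , refl , inj₂ (inj₁ refl) = inj₁ (∈Triangle i Y)
      ... | _ , _ , refl , inj₂ (inj₂ refl) = inj₁ (∈Triangle i X)
  Triangle-strong i (suc zero) =
    strong-criterion (F n) _ (Triangle-clique i (suc zero)) (combine i Y′) (combine i Z′)
      (∈Triangle i Y′) (∈Triangle i Z′) (_≡ combine i Y) (_≡ combine i Z) nbrY′ nbrZ′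
      (λ { _ _ refl refl → Equivalence.from (adj⇔Nbr i Y i Z) (inj₂ (inj₁ refl)) })
    where
      nbrY′ : ∀ w → Adj (F n) (combine i Y′) w → w ∈ Triangle i (suc zero) ⊎ w ≡ combine i Y
      nbrY′ w a with nbrOf i Y′ w a
      ... | _ , _ , refl , inj₁ refl        = inj₁ (∈Triangle i X′)
      ... | _ , _ , refl , inj₂ (inj₁ refl) = inj₁ (∈Triangle i Z′)
      ... | _ , _ , refl , inj₂ (inj₂ refl) = inj₂ refl
      nbrZ′ : ∀ w → Adj (F n) (combine i Z′) w → w ∈ Triangle i (suc zero) ⊎ w ≡ combine i Z
      nbrZ′ w a with nbrOf i Z′ w a
      ... | _ , _ , refl , inj₁ refl        = inj₁ (∈Triangle i X′)
      ... | _ , _ , refl , inj₂ (inj₁ refl) = inj₁ (∈Triangle i Y′)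
      ... | _ , _ , refl , inj₂ (inj₂ refl) = inj₂ refl

  localizable : Localizable (F n)
  localizable = n * 2 , part , λ c →
    subst (λ c′ → IsStrongClique (F n) (fibre (F n) part c′)) (combine-remQuot {n} 2 c)
          (Triangle-strong (proj₁ (remQuot {n} 2 c)) (proj₂ (remQuot {n} 2 c)))

module LocalStructure (G : Graph) (simple : IsSimple G) (cubic : Cubic G)
                      (connected : ∀ u v → Reachable G u v) where
  open CubicGraph G simple cubic public

  module _ (v : V) (C : VSet G) (strong : IsStrongClique G C) (v∈C : v ∈ C) where

    private
      clique : IsClique G C
      clique = proj₁ strong
      meets : ∀ S → IsMaximalIndependent G S → ∃ λ v → v ∈ C × v ∈ S
      meets = proj₂ strong

      ¬strong : (I : VSet G) → IsIndependent G I → (∀ c → c ∈ C → ∃ λ u → u ∈ I × A c u) → ⊥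
      ¬strong I ind dom = dominated⇒¬strong C I ind dom meets

      ∈C⇒ : ∀ w → w ∈ C → w ≡ v ⊎ A v w
      ∈C⇒ w w∈C with w ≟ v
      ... | yes e = inj₁ e
      ... | no ne = inj₂ (clique v w v∈C w∈C (λ e → ne (sym e)))

    C∋nbr : ∀ {p q r} → Nbhd A v p q r → p ∈ C ⊎ (q ∈ C ⊎ r ∈ C)
    C∋nbr {p} {q} {r} n with decT (C p) | decT (C q) | decT (C r)
    ... | yes p∈ | _      | _      = inj₁ p∈
    ... | no _   | yes q∈ | _      = inj₂ (inj₁ q∈)
    ... | no _   | no _   | yes r∈ = inj₂ (inj₂ r∈)
    ... | no p∉  | no q∉  | no r∉  = ⊥-elim (¬strong ⟦ p , p , p ⟧ (independent₃ A-irrefl A-irrefl A-irrefl) dom)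
      where
        dom : ∀ c → c ∈ C → ∃ λ u → u ∈ ⟦ p , p , p ⟧ × A c u
        dom c c∈C with ∈C⇒ c c∈C
        ... | inj₁ refl = p , ⟦⟧-∋₁ p p p , Nbhd.∼p n
        ... | inj₂ a with Nbhd.only n c a
        ...   | inj₁ refl        = ⊥-elim (p∉ c∈C)
        ...   | inj₂ (inj₁ refl) = ⊥-elim (q∉ c∈C)
        ...   | inj₂ (inj₂ refl) = ⊥-elim (r∉ c∈C)

    C≡edge⇒K33 : ∀ {p q r} → Nbhd A v p q r → p ∈ C → ¬ q ∈ C → ¬ r ∈ C → G ≅ K33
    C≡edge⇒K33 {p} {q} {r} n p∈C q∉C r∉C =
      ≅-from-neighbourhoods G K33 connected K33-table (lookup vertices) (λ {i} {j} → lookup-injective distinct i j) nbhds zero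
      where
        ∈C⇒v,p : ∀ w → w ∈ C → w ≡ v ⊎ w ≡ p
        ∈C⇒v,p w w∈C with ∈C⇒ w w∈C
        ... | inj₁ e = inj₁ e
        ... | inj₂ a with Nbhd.only n w a
        ...   | inj₁ e           = inj₂ e
        ...   | inj₂ (inj₁ refl) = ⊥-elim (q∉C w∈C)
        ...   | inj₂ (inj₂ refl) = ⊥-elim (r∉C w∈C)

        -- Otherwise {x, y} would be independent and dominate C = {v, p}.
        complete : ∀ {x y} → A v x → A p y → A x y
        complete {x} {y} ∼x ∼y with decT (adj G x y)
        ... | yes a = a
        ... | no ¬a = ⊥-elim (¬strong ⟦ x , y , y ⟧ (independent₃ ¬a ¬a A-irrefl) dom)
          where
            dom : ∀ c → c ∈ C → ∃ λ u → u ∈ ⟦ x , y , y ⟧ × A c u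
            dom c c∈C with ∈C⇒v,p c c∈C
            ... | inj₁ refl = x , ⟦⟧-∋₁ x y y , ∼x
            ... | inj₂ refl = y , ⟦⟧-∋₂ x y y , ∼y

        a₁ a₂ : V
        a₁ = proj₁ (nbhdWith₁ (A-sym (Nbhd.∼p n)))
        a₂ = proj₁ (proj₂ (nbhdWith₁ (A-sym (Nbhd.∼p n))))
        m : Nbhd A p v a₁ a₂
        m = proj₂ (proj₂ (nbhdWith₁ (A-sym (Nbhd.∼p n))))

        q∼a₁ : A q a₁
        q∼a₁ = complete (Nbhd.∼q n) (Nbhd.∼q m)
        q∼a₂ : A q a₂
        q∼a₂ = complete (Nbhd.∼q n) (Nbhd.∼r m)
        r∼a₁ : A r a₁
        r∼a₁ = complete (Nbhd.∼r n) (Nbhd.∼q m)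
        r∼a₂ : A r a₂
        r∼a₂ = complete (Nbhd.∼r n) (Nbhd.∼r m)

        vertices : Vec V 6
        vertices = v ∷ a₁ ∷ a₂ ∷ p ∷ q ∷ r ∷ []

        distinct : VecUnique.Unique vertices
        distinct =
          (Nbhd.p≢q m ∷ Nbhd.p≢r m ∷ A⇒≢ (Nbhd.∼p n) ∷ A⇒≢ (Nbhd.∼q n) ∷ A⇒≢ (Nbhd.∼r n) ∷ []) ∷
          (Nbhd.q≢r m ∷ ≢⇐A (Nbhd.∼q m) ∷ ≢⇐A q∼a₁ ∷ ≢⇐A r∼a₁ ∷ []) ∷
          (≢⇐A (Nbhd.∼r m) ∷ ≢⇐A q∼a₂ ∷ ≢⇐A r∼a₂ ∷ []) ∷
          (Nbhd.p≢q n ∷ Nbhd.p≢r n ∷ []) ∷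
          (Nbhd.q≢r n ∷ []) ∷ [] ∷ []

        open NeighbourTable K33-table
        nbhds : ∀ i → Nbhd A (lookup vertices i) (lookup vertices (n₁ i)) (lookup vertices (n₂ i)) (lookup vertices (n₃ i))
        nbhds zero             = n
        nbhds (suc zero)       = nbhdOf (A-sym (Nbhd.∼q m)) (A-sym q∼a₁) (A-sym r∼a₁) (Nbhd.p≢q n) (Nbhd.p≢r n) (Nbhd.q≢r n)
        nbhds (suc (suc zero)) = nbhdOf (A-sym (Nbhd.∼r m)) (A-sym q∼a₂) (A-sym r∼a₂) (Nbhd.p≢q n) (Nbhd.p≢r n) (Nbhd.q≢r n)
        nbhds X′ = m
        nbhds Y′ = nbhdOf (A-sym (Nbhd.∼q n)) q∼a₁ q∼a₂ (Nbhd.p≢q m) (Nbhd.p≢r m) (Nbhd.q≢r m)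
        nbhds Z′ = nbhdOf (A-sym (Nbhd.∼r n)) r∼a₁ r∼a₂ (Nbhd.p≢q m) (Nbhd.p≢r m) (Nbhd.q≢r m)

    C⊇nbhd⇒K4 : ∀ {p q r} → Nbhd A v p q r → p ∈ C → q ∈ C → r ∈ C → G ≅ K4
    C⊇nbhd⇒K4 {p} {q} {r} n p∈C q∈C r∈C =
      ≅-from-neighbourhoods G K4 connected K4-table (lookup vertices)
        (λ {i} {j} → lookup-injective distinct i j) nbhds zero
      where
        p∼q : A p q
        p∼q = clique p q p∈C q∈C (Nbhd.p≢q n)
        p∼r : A p r
        p∼r = clique p r p∈C r∈C (Nbhd.p≢r n)
        q∼r : A q r
        q∼r = clique q r q∈C r∈C (Nbhd.q≢r n)

        vertices : Vec V 4
        vertices = v ∷ p ∷ q ∷ r ∷ []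

        distinct : VecUnique.Unique vertices
        distinct = (A⇒≢ (Nbhd.∼p n) ∷ A⇒≢ (Nbhd.∼q n) ∷ A⇒≢ (Nbhd.∼r n) ∷ []) ∷
                   (Nbhd.p≢q n ∷ Nbhd.p≢r n ∷ []) ∷ (Nbhd.q≢r n ∷ []) ∷ [] ∷ []

        open NeighbourTable K4-table
        nbhds : ∀ i → Nbhd A (lookup vertices i) (lookup vertices (n₁ i)) (lookup vertices (n₂ i)) (lookup vertices (n₃ i))
        nbhds zero                   = n
        nbhds (suc zero)             = nbhdOf (A-sym (Nbhd.∼p n)) p∼q p∼r (A⇒≢ (Nbhd.∼q n)) (A⇒≢ (Nbhd.∼r n)) (Nbhd.q≢r n)
        nbhds (suc (suc zero))       = nbhdOf (A-sym (Nbhd.∼q n)) (A-sym p∼q) q∼r (A⇒≢ (Nbhd.∼p n)) (A⇒≢ (Nbhd.∼r n)) (Nbhd.p≢r n)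
        nbhds (suc (suc (suc zero))) = nbhdOf (A-sym (Nbhd.∼r n)) (A-sym p∼r) (A-sym q∼r) (A⇒≢ (Nbhd.∼p n)) (A⇒≢ (Nbhd.∼q n)) (Nbhd.p≢q n)

    C≡triangle⇒strongTriangle : ∀ {p q r} → Nbhd A v p q r → p ∈ C → q ∈ C → ¬ r ∈ C → StrongTriangle v p q
    C≡triangle⇒strongTriangle {p} {q} {r} n p∈C q∈C r∉C = record
      { ∼a = Nbhd.∼p n ; ∼b = Nbhd.∼q n ; a∼b = clique p q p∈C q∈C (Nbhd.p≢q n) ; outer-edge = outer-edge }
      where
        outer-edge : ∀ {v′ p′ q′} → Nbhd A v p q v′ → Nbhd A p v q p′ → Nbhd A q v p q′ →
                     A v′ p′ ⊎ (A v′ q′ ⊎ A p′ q′)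
        outer-edge {v′} {p′} {q′} nv np nq with decT (adj G v′ p′) | decT (adj G v′ q′) | decT (adj G p′ q′)
        ... | yes a | _     | _     = inj₁ a
        ... | no _  | yes a | _     = inj₂ (inj₁ a)
        ... | no _  | no _  | yes a = inj₂ (inj₂ a)
        ... | no ¬a | no ¬b | no ¬c = ⊥-elim (¬strong ⟦ v′ , p′ , q′ ⟧ (independent₃ ¬a ¬b ¬c) dom)
          where
            dom : ∀ c → c ∈ C → ∃ λ u → u ∈ ⟦ v′ , p′ , q′ ⟧ × A c u
            dom c c∈C with ∈C⇒ c c∈C
            ... | inj₁ refl = v′ , ⟦⟧-∋₁ v′ p′ q′ , Nbhd.∼r nv
            ... | inj₂ a with Nbhd.only n c a
            ...   | inj₁ refl        = p′ , ⟦⟧-∋₂ v′ p′ q′ , Nbhd.∼r np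
            ...   | inj₂ (inj₁ refl) = q′ , ⟦⟧-∋₃ v′ p′ q′ , Nbhd.∼r nq
            ...   | inj₂ (inj₂ refl) = ⊥-elim (r∉C c∈C)

    strongClique-cases : (G ≅ K4) ⊎ ((G ≅ K33) ⊎ Σ V λ a → Σ V λ b → StrongTriangle v a b)
    strongClique-cases with nbhd v
    ... | p , q , r , n with decT (C p) | decT (C q) | decT (C r)
    ... | yes p∈ | yes q∈ | yes r∈ = inj₁ (C⊇nbhd⇒K4 n p∈ q∈ r∈)
    ... | yes p∈ | yes q∈ | no r∉  = inj₂ (inj₂ (p , q , C≡triangle⇒strongTriangle n p∈ q∈ r∉))
    ... | yes p∈ | no q∉  | yes r∈ = inj₂ (inj₂ (p , r , C≡triangle⇒strongTriangle (swap₂₃ n) p∈ r∈ q∉))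
    ... | no p∉  | yes q∈ | yes r∈ = inj₂ (inj₂ (q , r , C≡triangle⇒strongTriangle (rotate n) q∈ r∈ p∉))
    ... | yes p∈ | no q∉  | no r∉  = inj₂ (inj₁ (C≡edge⇒K33 n p∈ q∉ r∉))
    ... | no p∉  | yes q∈ | no r∉  = inj₂ (inj₁ (C≡edge⇒K33 (swap₁₂ n) q∈ p∉ r∉))
    ... | no p∉  | no q∉  | yes r∈ = inj₂ (inj₁ (C≡edge⇒K33 (rotate (rotate n)) r∈ p∉ q∉))
    ... | no p∉  | no q∉  | no r∉  with C∋nbr n
    ...   | inj₁ p∈        = ⊥-elim (p∉ p∈)
    ...   | inj₂ (inj₁ q∈) = ⊥-elim (q∉ q∈)
    ...   | inj₂ (inj₂ r∈) = ⊥-elim (r∉ r∈)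

-- Graphs in which every vertex lies in a strong triangle

module Ladder (G : Graph) (simple : IsSimple G) (cubic : Cubic G)
  (strongTriangleAt : ∀ v → Σ (Fin (order G)) λ a → Σ (Fin (order G)) λ b →
                       CubicGraph.StrongTriangle G simple cubic v a b) where
  open CubicGraph G simple cubic public


  triangle⇒nbrs-adjacent : ∀ {v p q r a b} → Nbhd A v p q r → A v a → A v b → A a b → A p q ⊎ (A p r ⊎ A q r)
  triangle⇒nbrs-adjacent n v∼a v∼b a∼b with Nbhd.only n _ v∼a | Nbhd.only n _ v∼b
  ... | inj₁ refl | inj₁ refl = ⊥-elim (A-irrefl a∼b)
  ... | inj₁ refl | inj₂ (inj₁ refl) = inj₁ a∼b
  ... | inj₁ refl | inj₂ (inj₂ refl) = inj₂ (inj₁ a∼b)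
  ... | inj₂ (inj₁ refl) | inj₁ refl = inj₁ (A-sym a∼b)
  ... | inj₂ (inj₁ refl) | inj₂ (inj₁ refl) = ⊥-elim (A-irrefl a∼b)
  ... | inj₂ (inj₁ refl) | inj₂ (inj₂ refl) = inj₂ (inj₂ a∼b)
  ... | inj₂ (inj₂ refl) | inj₁ refl = inj₂ (inj₁ (A-sym a∼b))
  ... | inj₂ (inj₂ refl) | inj₂ (inj₁ refl) = inj₂ (inj₂ (A-sym a∼b))
  ... | inj₂ (inj₂ refl) | inj₂ (inj₂ refl) = ⊥-elim (A-irrefl a∼b)

  nbrs-adjacent : ∀ {v p q r} → Nbhd A v p q r → A p q ⊎ (A p r ⊎ A q r)
  nbrs-adjacent {v} n with strongTriangleAt v
  ... | a , b , st = triangle⇒nbrs-adjacent n (StrongTriangle.∼a st) (StrongTriangle.∼b st) (StrongTriangle.a∼b st)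

  -- The tip q = x′ᵢ of a block of Fₙ together with its triangle x′ᵢ y′ᵢ z′ᵢ, its outer
  -- neighbour o = xᵢ₋₁, and the rungs y′ᵢ yᵢ and z′ᵢ zᵢ.
  record Port (q : V) : Set where
    field
      y′ z′ o y z : V
      Nq : Nbhd A q y′ z′ o
      Ny′ : Nbhd A y′ q z′ y
      Nz′ : Nbhd A z′ q y′ z
      y∼z : A y z

  -- A whole block: xᵢ is the common third neighbour of yᵢ and zᵢ, and ox = x′ᵢ₊₁.
  record Unit (q : V) : Set where
    field
      P : Port q
    open Port P public
    field
      x ox : V
      Ny : Nbhd A y y′ z x
      Nz : Nbhd A z z′ y x
      Nx : Nbhd A x y z ox

  module _ {q y′ z′ o y z : V} (Nq : Nbhd A q y′ z′ o) (Ny′ : Nbhd A y′ q z′ y) (Nz′ : Nbhd A z′ q y′ z) (y∼z : A y z) where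
    ¬y∼z′ : ¬ A y z′
    ¬y∼z′ a with Nbhd.only Nz′ y (A-sym a)
    ... | inj₁ e = Nbhd.p≢r Ny′ (sym e)
    ... | inj₂ (inj₁ e) = A⇒≢ (Nbhd.∼r Ny′) (sym e)
    ... | inj₂ (inj₂ e) = A⇒≢ y∼z e
    ¬z∼y′ : ¬ A z y′
    ¬z∼y′ a with Nbhd.only Ny′ z (A-sym a)
    ... | inj₁ e = Nbhd.p≢r Nz′ (sym e)
    ... | inj₂ (inj₁ e) = A⇒≢ (Nbhd.∼r Nz′) (sym e)
    ... | inj₂ (inj₂ e) = A⇒≢ y∼z (sym e)
    y≡o⇒¬z∼q : y ≡ o → ¬ A z q
    y≡o⇒¬z∼q yo a with Nbhd.only Nq z (A-sym a)
    ... | inj₁ e = Nbhd.q≢r Nz′ (sym e)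
    ... | inj₂ (inj₁ e) = A⇒≢ (Nbhd.∼r Nz′) (sym e)
    ... | inj₂ (inj₂ e) = A⇒≢ y∼z (trans yo (sym e))

    ¬y∼q : ∀ {c} → Nbhd A y y′ z c → A y q → ⊥
    ¬y∼q {c} Ny a with third-unique Nq (A-sym a) (A⇒≢ (A-sym (Nbhd.∼r Ny′))) (λ e → Nbhd.q≢r Ny′ (sym e))
    ... | y≡o with nbhdWith₂ (A-sym (Nbhd.∼r Nz′)) (A-sym y∼z) (Nbhd.q≢r Ny′)
    ... | w , Nw with nbrs-adjacent Nw
    ... | inj₁ z′∼y = ¬y∼z′ (A-sym z′∼y)
    ... | inj₂ (inj₁ z′∼w) with Nbhd.only Nz′ w z′∼w
    ... | inj₁ refl = y≡o⇒¬z∼q y≡o (Nbhd.∼r Nw)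
    ... | inj₂ (inj₁ refl) = ¬z∼y′ (Nbhd.∼r Nw)
    ... | inj₂ (inj₂ refl) = A-irrefl (Nbhd.∼r Nw)
    ¬y∼q {c} Ny a | y≡o | w , Nw | inj₂ (inj₂ y∼w) with Nbhd.only Ny w y∼w
    ... | inj₁ refl = ¬z∼y′ (Nbhd.∼r Nw)
    ... | inj₂ (inj₁ refl) = A-irrefl (Nbhd.∼r Nw)
    ... | inj₂ (inj₂ refl) = y≡o⇒¬z∼q y≡o (subst (A z) (sym q≡c) (Nbhd.∼r Nw))
      where
        q≡c : q ≡ c
        q≡c = third-unique Ny a (λ e → A⇒≢ (Nbhd.∼p Ny′) (sym e)) (λ e → Nbhd.p≢r Nz′ e)

    z∼x : ∀ {c} → Nbhd A y y′ z c → A z c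
    z∼x {c} Ny with nbrs-adjacent Ny
    ... | inj₁ a = ⊥-elim (¬z∼y′ (A-sym a))
    ... | inj₂ (inj₂ a) = a
    ... | inj₂ (inj₁ a) with Nbhd.only Ny′ c a
    ...   | inj₁ refl = ⊥-elim (¬y∼q Ny (Nbhd.∼r Ny))
    ...   | inj₂ (inj₁ refl) = ⊥-elim (¬y∼z′ (Nbhd.∼r Ny))
    ...   | inj₂ (inj₂ refl) = ⊥-elim (A-irrefl (Nbhd.∼r Ny))

    Nz-from-Ny : ∀ {c} → Nbhd A y y′ z c → Nbhd A z z′ y c
    Nz-from-Ny Ny = nbhdOf (A-sym (Nbhd.∼r Nz′)) (A-sym y∼z) (z∼x Ny) (Nbhd.q≢r Ny′)
              (λ e → ¬y∼z′ (subst (A y) (sym e) (Nbhd.∼r Ny))) (A⇒≢ (Nbhd.∼r Ny))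

  completeUnit : ∀ {q} → Port q → Unit q
  completeUnit {q} P = record { P = P ; x = proj₁ t ; ox = proj₁ tx ; Ny = proj₂ t ; Nz = Nz-from-Ny Nq Ny′ Nz′ y∼z (proj₂ t) ; Nx = proj₂ tx }
    where
      open Port P
      t : Σ V λ x → Nbhd A y y′ z x
      t = nbhdWith₂ (A-sym (Nbhd.∼r Ny′)) y∼z (Nbhd.q≢r Nz′)
      tx : Σ V λ ox → Nbhd A (proj₁ t) y z ox
      tx = nbhdWith₂ (A-sym (Nbhd.∼r (proj₂ t))) (A-sym (z∼x Nq Ny′ Nz′ y∼z (proj₂ t))) (A⇒≢ y∼z)

  -- Unless the ladder closes at once (o = x), the strong triangle at o avoids q, since o
  -- and q have no common neighbour; its outer edge then makes o the tip of a port
  -- facing back towards q.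
  module _ {q y′ z′ o y z x : V} (Nq : Nbhd A q y′ z′ o) (Ny′ : Nbhd A y′ q z′ y)
           (Nz′ : Nbhd A z′ q y′ z) (y∼z : A y z) (Ny : Nbhd A y y′ z x) (Nz : Nbhd A z z′ y x)
           (o≢x : o ≢ x) where
    private
      ¬y∼q′ : ¬ A y q
      ¬y∼q′ = ¬y∼q Nq Ny′ Nz′ y∼z Ny
      ¬z∼q : ¬ A z q
      ¬z∼q = ¬y∼q (swap₁₂ Nq) Nz′ Ny′ (A-sym y∼z) Nz

    ¬commonNbr : ∀ {w} → A o w → A q w → ⊥
    ¬commonNbr {w} o∼w q∼w with Nbhd.only Nq w q∼w
    ... | inj₂ (inj₂ refl) = A-irrefl o∼w
    ... | inj₁ refl with Nbhd.only Ny′ o (A-sym o∼w)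
    ...   | inj₁ refl        = A-irrefl (Nbhd.∼r Nq)
    ...   | inj₂ (inj₁ e)    = Nbhd.q≢r Nq (sym e)
    ...   | inj₂ (inj₂ refl) = ¬y∼q′ (A-sym (Nbhd.∼r Nq))
    ¬commonNbr {w} o∼w q∼w | inj₂ (inj₁ refl) with Nbhd.only Nz′ o (A-sym o∼w)
    ...   | inj₁ refl        = A-irrefl (Nbhd.∼r Nq)
    ...   | inj₂ (inj₁ e)    = Nbhd.p≢r Nq (sym e)
    ...   | inj₂ (inj₂ refl) = ¬z∼q (A-sym (Nbhd.∼r Nq))

    ¬q∼outer : ∀ {s t s′} → A o s → s ≢ q → Nbhd A s o t s′ → A q s′ → ⊥
    ¬q∼outer {s} {t} {s′} o∼s s≢q Ns q∼s′ with Nbhd.only Nq s′ q∼s′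
    ... | inj₂ (inj₂ refl) = Nbhd.p≢r Ns refl
    ... | inj₁ refl with Nbhd.only Ny′ s (A-sym (Nbhd.∼r Ns))
    ...   | inj₁ e           = s≢q e
    ...   | inj₂ (inj₁ refl) = ¬commonNbr o∼s (Nbhd.∼q Nq)
    ...   | inj₂ (inj₂ refl) with Nbhd.only Ny o (A-sym o∼s)
    ...     | inj₁ e           = Nbhd.p≢r Nq (sym e)
    ...     | inj₂ (inj₁ refl) = ¬z∼q (A-sym (Nbhd.∼r Nq))
    ...     | inj₂ (inj₂ e)    = o≢x e
    ¬q∼outer {s} {t} {s′} o∼s s≢q Ns q∼s′ | inj₂ (inj₁ refl) with Nbhd.only Nz′ s (A-sym (Nbhd.∼r Ns))
    ...   | inj₁ e           = s≢q e
    ...   | inj₂ (inj₁ refl) = ¬commonNbr o∼s (Nbhd.∼p Nq)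
    ...   | inj₂ (inj₂ refl) with Nbhd.only Nz o (A-sym o∼s)
    ...     | inj₁ e           = Nbhd.q≢r Nq (sym e)
    ...     | inj₂ (inj₁ refl) = ¬y∼q′ (A-sym (Nbhd.∼r Nq))
    ...     | inj₂ (inj₂ e)    = o≢x e

    nbhd-o : ∀ {s t} → StrongTriangle o s t → Nbhd A o q s t
    nbhd-o {s} {t} T = nbhdOf (A-sym (Nbhd.∼r Nq)) ∼a ∼b (λ e → s≢q (sym e)) (λ e → t≢q (sym e)) (A⇒≢ a∼b)
      where
        open StrongTriangle T
        s≢q : s ≢ q
        s≢q refl = ¬commonNbr ∼b a∼b
        t≢q : t ≢ q
        t≢q refl = ¬commonNbr ∼a (A-sym a∼b)

    portBack : Σ (Port o) λ P′ → Port.o P′ ≡ q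
    portBack with strongTriangleAt o
    ... | s , t , T with nbhdWith₂ (A-sym (StrongTriangle.∼a T)) (StrongTriangle.a∼b T) (A⇒≢ (StrongTriangle.∼b T))
                       | nbhdWith₂ (A-sym (StrongTriangle.∼b T)) (A-sym (StrongTriangle.a∼b T)) (A⇒≢ (StrongTriangle.∼a T))
    ... | s′ , Ns | t′ , Nt with StrongTriangle.outer-edge T (rotate (nbhd-o T)) Ns Nt
    ...   | inj₂ (inj₂ s′∼t′) =
      record { y′ = s ; z′ = t ; o = q ; y = s′ ; z = t′ ; Nq = rotate (nbhd-o T) ; Ny′ = Ns ; Nz′ = Nt ; y∼z = s′∼t′ } , refl
    ...   | inj₁ q∼s′         = ⊥-elim (¬q∼outer (StrongTriangle.∼a T) (λ e → Nbhd.p≢q (nbhd-o T) (sym e)) Ns q∼s′)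
    ...   | inj₂ (inj₁ q∼t′)  = ⊥-elim (¬q∼outer (StrongTriangle.∼b T) (λ e → Nbhd.p≢r (nbhd-o T) (sym e)) Nt q∼t′)

  port-at-outer : ∀ {q y′ z′ o y z x ox} → Nbhd A q y′ z′ o → Nbhd A y′ q z′ y → Nbhd A z′ q y′ z → A y z →
                  Nbhd A y y′ z x → Nbhd A z z′ y x → Nbhd A x y z ox → Σ (Port o) λ P′ → Port.o P′ ≡ q
  port-at-outer {o = o} {y} {z} {x} {ox} Nq Ny′ Nz′ y∼z Ny Nz Nx with o ≟ x
  ... | no o≢x   = portBack Nq Ny′ Nz′ y∼z Ny Nz o≢x
  ... | yes refl =
    record { y′ = y ; z′ = z ; o = ox ; y = _ ; z = _ ; Nq = Nx ; Ny′ = swap₁₂ (rotate Ny)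
           ; Nz′ = swap₁₂ (rotate Nz) ; y∼z = Nbhd.∼q Ny′ } ,
    sym (third-unique Nx (A-sym (Nbhd.∼r Nq)) (Nbhd.p≢r Ny′) (Nbhd.p≢r Nz′))

  somePort : V → Σ V Port
  somePort v with strongTriangleAt v
  ... | a , b , T with nbhdWith₂ ∼a ∼b (A⇒≢ a∼b) | nbhdWith₂ (A-sym ∼a) a∼b (A⇒≢ ∼b) | nbhdWith₂ (A-sym ∼b) (A-sym a∼b) (A⇒≢ ∼a)
    where open StrongTriangle T
  ... | v′ , Nv | a′ , Na | b′ , Nb with StrongTriangle.outer-edge T Nv Na Nb
  ...   | inj₁ v′∼a′        = b , record { y′ = v ; z′ = a ; o = b′ ; y = v′ ; z = a′ ; Nq = Nb ; Ny′ = swap₁₂ Nv ; Nz′ = swap₁₂ Na ; y∼z = v′∼a′ }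
  ...   | inj₂ (inj₁ v′∼b′) = a , record { y′ = v ; z′ = b ; o = a′ ; y = v′ ; z = b′ ; Nq = Na ; Ny′ = Nv ; Nz′ = swap₁₂ Nb ; y∼z = v′∼b′ }
  ...   | inj₂ (inj₂ a′∼b′) = v , record { y′ = a ; z′ = b ; o = v′ ; y = a′ ; z = b′ ; Nq = Nv ; Ny′ = Na ; Nz′ = Nb ; y∼z = a′∼b′ }

  nextPort : ∀ {q} (U : Unit q) → Σ (Port (Unit.ox U)) λ P′ → Port.o P′ ≡ Unit.x U
  nextPort U = port-at-outer (Unit.Nx U) (swap₁₂ (rotate (Unit.Ny U))) (swap₁₂ (rotate (Unit.Nz U)))
                 (Nbhd.∼q (Unit.Ny′ U)) (swap₁₂ (rotate (Unit.Ny′ U))) (swap₁₂ (rotate (Unit.Nz′ U))) (Unit.Nq U)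

  nextBlock : Σ V Port → Σ V Port
  nextBlock (q , P) = Unit.ox (completeUnit P) , proj₁ (nextPort (completeUnit P))

-- An infinite ladder in a finite graph closes up

pattern p0 = zero
pattern p1 = suc zero
pattern p2 = suc (suc zero)
pattern p3 = suc (suc (suc zero))
pattern p4 = suc (suc (suc (suc zero)))
pattern p5 = suc (suc (suc (suc (suc zero))))

six : ℕ → ℕ
six zero = 0
six (suc a) = 6 + six a

index : ℕ → Fin 6 → ℕ
index a r = toℕ r + six a

-- The edges of the infinite ladder, whose a-th block is listed as x′ y′ z′ y z x
-- (positions p0 … p5); vertex (a , r) has index 6a + r.
data Edge∞ : ℕ → Fin 6 → ℕ → Fin 6 → Set where
  n01 : ∀ {a} → Edge∞ a p0 a p1
  n02 : ∀ {a} → Edge∞ a p0 a p2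
  n05 : ∀ {a} → Edge∞ (suc a) p0 a p5
  n10 : ∀ {a} → Edge∞ a p1 a p0
  n12 : ∀ {a} → Edge∞ a p1 a p2
  n13 : ∀ {a} → Edge∞ a p1 a p3
  n20 : ∀ {a} → Edge∞ a p2 a p0
  n21 : ∀ {a} → Edge∞ a p2 a p1
  n24 : ∀ {a} → Edge∞ a p2 a p4
  n31 : ∀ {a} → Edge∞ a p3 a p1
  n34 : ∀ {a} → Edge∞ a p3 a p4
  n35 : ∀ {a} → Edge∞ a p3 a p5
  n42 : ∀ {a} → Edge∞ a p4 a p2
  n43 : ∀ {a} → Edge∞ a p4 a p3
  n45 : ∀ {a} → Edge∞ a p4 a p5
  n53 : ∀ {a} → Edge∞ a p5 a p3
  n54 : ∀ {a} → Edge∞ a p5 a p4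
  n50 : ∀ {a} → Edge∞ a p5 (suc a) p0

Edge∞-sym : ∀ {a r b s} → Edge∞ a r b s → Edge∞ b s a r
Edge∞-sym n01 = n10
Edge∞-sym n02 = n20
Edge∞-sym n05 = n50
Edge∞-sym n10 = n01
Edge∞-sym n12 = n21
Edge∞-sym n13 = n31
Edge∞-sym n20 = n02
Edge∞-sym n21 = n12
Edge∞-sym n24 = n42
Edge∞-sym n31 = n13
Edge∞-sym n34 = n43
Edge∞-sym n35 = n53
Edge∞-sym n42 = n24
Edge∞-sym n43 = n34
Edge∞-sym n45 = n54
Edge∞-sym n53 = n35
Edge∞-sym n54 = n45
Edge∞-sym n50 = n05

position : ℕ → ℕ × Fin 6
position zero = 0 , p0
position (suc zero) = 0 , p1
position (suc (suc zero)) = 0 , p2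
position (suc (suc (suc zero))) = 0 , p3
position (suc (suc (suc (suc zero)))) = 0 , p4
position (suc (suc (suc (suc (suc zero))))) = 0 , p5
position (suc (suc (suc (suc (suc (suc i)))))) = suc (proj₁ (position i)) , proj₂ (position i)

position-index : ∀ a r → position (index a r) ≡ (a , r)
position-index zero p0 = refl
position-index zero p1 = refl
position-index zero p2 = refl
position-index zero p3 = refl
position-index zero p4 = refl
position-index zero p5 = refl
position-index (suc a) p0 = cong (λ p → suc (proj₁ p) , proj₂ p) (position-index a p0)
position-index (suc a) p1 = cong (λ p → suc (proj₁ p) , proj₂ p) (position-index a p1)
position-index (suc a) p2 = cong (λ p → suc (proj₁ p) , proj₂ p) (position-index a p2)
position-index (suc a) p3 = cong (λ p → suc (proj₁ p) , proj₂ p) (position-index a p3)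
position-index (suc a) p4 = cong (λ p → suc (proj₁ p) , proj₂ p) (position-index a p4)
position-index (suc a) p5 = cong (λ p → suc (proj₁ p) , proj₂ p) (position-index a p5)

index-suc : ∀ a r → index (suc a) r ≡ 6 + index a r
index-suc a p0 = refl
index-suc a p1 = refl
index-suc a p2 = refl
index-suc a p3 = refl
index-suc a p4 = refl
index-suc a p5 = refl

index-position : ∀ i → index (proj₁ (position i)) (proj₂ (position i)) ≡ i
index-position zero = refl
index-position (suc zero) = refl
index-position (suc (suc zero)) = refl
index-position (suc (suc (suc zero))) = refl
index-position (suc (suc (suc (suc zero)))) = refl
index-position (suc (suc (suc (suc (suc zero))))) = refl
index-position (suc (suc (suc (suc (suc (suc i)))))) = trans (index-suc (proj₁ (position i)) (proj₂ (position i))) (cong (λ k → 6 + k) (index-position i))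

index-injective : ∀ {a r b s} → index a r ≡ index b s → a ≡ b × r ≡ s
index-injective {a} {r} {b} {s} e with trans (sym (position-index a r)) (trans (cong position e) (position-index b s))
... | refl = refl , refl

Edge∞-gap : ∀ {a r b s} → Edge∞ a r b s → index b s ≤ 2 + index a r
Edge∞-gap (n01 {a}) = m≤n+m _ 1
Edge∞-gap (n02 {a}) = m≤n+m _ 0
Edge∞-gap (n05 {a}) = m≤n+m _ 3
Edge∞-gap (n10 {a}) = m≤n+m _ 3
Edge∞-gap (n12 {a}) = m≤n+m _ 1
Edge∞-gap (n13 {a}) = m≤n+m _ 0
Edge∞-gap (n20 {a}) = m≤n+m _ 4
Edge∞-gap (n21 {a}) = m≤n+m _ 3
Edge∞-gap (n24 {a}) = m≤n+m _ 0
Edge∞-gap (n31 {a}) = m≤n+m _ 4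
Edge∞-gap (n34 {a}) = m≤n+m _ 1
Edge∞-gap (n35 {a}) = m≤n+m _ 0
Edge∞-gap (n42 {a}) = m≤n+m _ 4
Edge∞-gap (n43 {a}) = m≤n+m _ 3
Edge∞-gap (n45 {a}) = m≤n+m _ 1
Edge∞-gap (n53 {a}) = m≤n+m _ 4
Edge∞-gap (n54 {a}) = m≤n+m _ 3
Edge∞-gap (n50 {a}) = m≤n+m _ 1

Edge∞-earlier : ∀ a r → ¬ (a ≡ 0 × r ≡ p0) → Σ ℕ λ b → Σ (Fin 6) λ s → Edge∞ a r b s × index b s < index a r
Edge∞-earlier zero p0 nz = ⊥-elim (nz (refl , refl))
Edge∞-earlier (suc a) p0 nz = _ , _ , n05 , m≤n+m _ 0
Edge∞-earlier a p1 nz = _ , _ , n10 , m≤n+m _ 0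
Edge∞-earlier a p2 nz = _ , _ , n20 , m≤n+m _ 1
Edge∞-earlier a p3 nz = _ , _ , n31 , m≤n+m _ 1
Edge∞-earlier a p4 nz = _ , _ , n42 , m≤n+m _ 1
Edge∞-earlier a p5 nz = _ , _ , n53 , m≤n+m _ 1

Edge∞-consecutive : ∀ {a r b s c t} → Edge∞ b s c t → index c t ≡ 2 + index b s → index a r ≡ 1 + index b s → Edge∞ b s a r ⊎ Edge∞ a r c t
Edge∞-consecutive (n01 {b}) e _ = ⊥-elim (<-irrefl e (m≤n+m _ 0))
Edge∞-consecutive {a} {r} (n02 {b}) e e′ with index-injective {a} {r} {b} {p1} e′
... | refl , refl = inj₁ n01
Edge∞-consecutive (n05 {b}) e _ = ⊥-elim (<-irrefl e (m≤n+m _ 2))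
Edge∞-consecutive (n10 {b}) e _ = ⊥-elim (<-irrefl e (m≤n+m _ 2))
Edge∞-consecutive (n12 {b}) e _ = ⊥-elim (<-irrefl e (m≤n+m _ 0))
Edge∞-consecutive {a} {r} (n13 {b}) e e′ with index-injective {a} {r} {b} {p2} e′
... | refl , refl = inj₁ n12
Edge∞-consecutive (n20 {b}) e _ = ⊥-elim (<-irrefl e (m≤n+m _ 3))
Edge∞-consecutive (n21 {b}) e _ = ⊥-elim (<-irrefl e (m≤n+m _ 2))
Edge∞-consecutive {a} {r} (n24 {b}) e e′ with index-injective {a} {r} {b} {p3} e′
... | refl , refl = inj₂ n34
Edge∞-consecutive (n31 {b}) e _ = ⊥-elim (<-irrefl e (m≤n+m _ 3))
Edge∞-consecutive (n34 {b}) e _ = ⊥-elim (<-irrefl e (m≤n+m _ 0))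
Edge∞-consecutive {a} {r} (n35 {b}) e e′ with index-injective {a} {r} {b} {p4} e′
... | refl , refl = inj₁ n34
Edge∞-consecutive (n42 {b}) e _ = ⊥-elim (<-irrefl e (m≤n+m _ 3))
Edge∞-consecutive (n43 {b}) e _ = ⊥-elim (<-irrefl e (m≤n+m _ 2))
Edge∞-consecutive (n45 {b}) e _ = ⊥-elim (<-irrefl e (m≤n+m _ 0))
Edge∞-consecutive (n53 {b}) e _ = ⊥-elim (<-irrefl e (m≤n+m _ 3))
Edge∞-consecutive (n54 {b}) e _ = ⊥-elim (<-irrefl e (m≤n+m _ 2))
Edge∞-consecutive (n50 {b}) e _ = ⊥-elim (<-irrefl e (m≤n+m _ 0))


searchBelow : ∀ {P : ℕ → Set} → (∀ m → Dec (P m)) → ∀ b → (∀ k → k < b → ¬ P k) ⊎ Σ ℕ λ m → P m × (∀ k → k < m → ¬ P k)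
searchBelow d zero = inj₁ (λ k ())
searchBelow d (suc b) with searchBelow d b
... | inj₂ r = inj₂ r
... | inj₁ none with d b
... | yes p = inj₂ (b , p , none)
... | no np = inj₁ f
  where
    f : ∀ k → k < suc b → ¬ _
    f k (s≤s k≤b) with m≤n⇒m<n∨m≡n k≤b
    ... | inj₁ lt = none k lt
    ... | inj₂ refl = np

leastWitness : ∀ {P : ℕ → Set} → (∀ m → Dec (P m)) → ∀ M → P M → Σ ℕ λ m → P m × (∀ k → k < m → ¬ P k)
leastWitness d M pM with searchBelow d (suc M)
... | inj₂ r = r
... | inj₁ none = ⊥-elim (none M (n<1+n M) pM)

module Closing (G : Graph) (simple : IsSimple G)
  (W : ℕ → Fin 6 → Fin (order G)) (o : Fin (order G))
  (H00 : Nbhd (Adj G) (W 0 p0) (W 0 p1) (W 0 p2) o)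
  (H0 : ∀ a → Nbhd (Adj G) (W (suc a) p0) (W (suc a) p1) (W (suc a) p2) (W a p5))
  (H1 : ∀ a → Nbhd (Adj G) (W a p1) (W a p0) (W a p2) (W a p3))
  (H2 : ∀ a → Nbhd (Adj G) (W a p2) (W a p0) (W a p1) (W a p4))
  (H3 : ∀ a → Nbhd (Adj G) (W a p3) (W a p1) (W a p4) (W a p5))
  (H4 : ∀ a → Nbhd (Adj G) (W a p4) (W a p2) (W a p3) (W a p5))
  (H5 : ∀ a → Nbhd (Adj G) (W a p5) (W a p3) (W a p4) (W (suc a) p0)) where
  open SimpleGraph G simple

  outer₀ : ℕ → Fin (order G)
  outer₀ zero = o
  outer₀ (suc a) = W a p5

  H0* : ∀ a → Nbhd A (W a p0) (W a p1) (W a p2) (outer₀ a)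
  H0* zero = H00
  H0* (suc a) = H0 a

  W-adj : ∀ {a r b s} → Edge∞ a r b s → A (W a r) (W b s)
  W-adj (n01 {a}) = Nbhd.∼p (H0* a)
  W-adj (n02 {a}) = Nbhd.∼q (H0* a)
  W-adj (n05 {a}) = Nbhd.∼r (H0* (suc a))
  W-adj (n10 {a}) = Nbhd.∼p (H1 a)
  W-adj (n12 {a}) = Nbhd.∼q (H1 a)
  W-adj (n13 {a}) = Nbhd.∼r (H1 a)
  W-adj (n20 {a}) = Nbhd.∼p (H2 a)
  W-adj (n21 {a}) = Nbhd.∼q (H2 a)
  W-adj (n24 {a}) = Nbhd.∼r (H2 a)
  W-adj (n31 {a}) = Nbhd.∼p (H3 a)
  W-adj (n34 {a}) = Nbhd.∼q (H3 a)
  W-adj (n35 {a}) = Nbhd.∼r (H3 a)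
  W-adj (n42 {a}) = Nbhd.∼p (H4 a)
  W-adj (n43 {a}) = Nbhd.∼q (H4 a)
  W-adj (n45 {a}) = Nbhd.∼r (H4 a)
  W-adj (n53 {a}) = Nbhd.∼p (H5 a)
  W-adj (n54 {a}) = Nbhd.∼q (H5 a)
  W-adj (n50 {a}) = Nbhd.∼r (H5 a)

  W-nbrs-distinct : ∀ {a r b s c t} → Edge∞ a r b s → Edge∞ a r c t → ¬ (b ≡ c × s ≡ t) → W b s ≢ W c t
  W-nbrs-distinct (n01 {a}) (n01) ne = ⊥-elim (ne (refl , refl))
  W-nbrs-distinct (n01 {a}) (n02) ne = Nbhd.p≢q (H0* a)
  W-nbrs-distinct (n01 {suc a}) (n05 {a}) ne = Nbhd.p≢r (H0* (suc a))
  W-nbrs-distinct (n02 {a}) (n01) ne = λ e → Nbhd.p≢q (H0* a) (sym e)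
  W-nbrs-distinct (n02 {a}) (n02) ne = ⊥-elim (ne (refl , refl))
  W-nbrs-distinct (n02 {suc a}) (n05 {a}) ne = Nbhd.q≢r (H0* (suc a))
  W-nbrs-distinct (n05 {a}) (n01 {suc a}) ne = λ e → Nbhd.p≢r (H0* (suc a)) (sym e)
  W-nbrs-distinct (n05 {a}) (n02 {suc a}) ne = λ e → Nbhd.q≢r (H0* (suc a)) (sym e)
  W-nbrs-distinct (n05 {a}) (n05 {a}) ne = ⊥-elim (ne (refl , refl))
  W-nbrs-distinct (n10 {a}) n10 ne = ⊥-elim (ne (refl , refl))
  W-nbrs-distinct (n10 {a}) n12 ne = Nbhd.p≢q (H1 a)
  W-nbrs-distinct (n10 {a}) n13 ne = Nbhd.p≢r (H1 a)
  W-nbrs-distinct (n12 {a}) n10 ne = λ e → Nbhd.p≢q (H1 a) (sym e)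
  W-nbrs-distinct (n12 {a}) n12 ne = ⊥-elim (ne (refl , refl))
  W-nbrs-distinct (n12 {a}) n13 ne = Nbhd.q≢r (H1 a)
  W-nbrs-distinct (n13 {a}) n10 ne = λ e → Nbhd.p≢r (H1 a) (sym e)
  W-nbrs-distinct (n13 {a}) n12 ne = λ e → Nbhd.q≢r (H1 a) (sym e)
  W-nbrs-distinct (n13 {a}) n13 ne = ⊥-elim (ne (refl , refl))
  W-nbrs-distinct (n20 {a}) n20 ne = ⊥-elim (ne (refl , refl))
  W-nbrs-distinct (n20 {a}) n21 ne = Nbhd.p≢q (H2 a)
  W-nbrs-distinct (n20 {a}) n24 ne = Nbhd.p≢r (H2 a)
  W-nbrs-distinct (n21 {a}) n20 ne = λ e → Nbhd.p≢q (H2 a) (sym e)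
  W-nbrs-distinct (n21 {a}) n21 ne = ⊥-elim (ne (refl , refl))
  W-nbrs-distinct (n21 {a}) n24 ne = Nbhd.q≢r (H2 a)
  W-nbrs-distinct (n24 {a}) n20 ne = λ e → Nbhd.p≢r (H2 a) (sym e)
  W-nbrs-distinct (n24 {a}) n21 ne = λ e → Nbhd.q≢r (H2 a) (sym e)
  W-nbrs-distinct (n24 {a}) n24 ne = ⊥-elim (ne (refl , refl))
  W-nbrs-distinct (n31 {a}) n31 ne = ⊥-elim (ne (refl , refl))
  W-nbrs-distinct (n31 {a}) n34 ne = Nbhd.p≢q (H3 a)
  W-nbrs-distinct (n31 {a}) n35 ne = Nbhd.p≢r (H3 a)
  W-nbrs-distinct (n34 {a}) n31 ne = λ e → Nbhd.p≢q (H3 a) (sym e)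
  W-nbrs-distinct (n34 {a}) n34 ne = ⊥-elim (ne (refl , refl))
  W-nbrs-distinct (n34 {a}) n35 ne = Nbhd.q≢r (H3 a)
  W-nbrs-distinct (n35 {a}) n31 ne = λ e → Nbhd.p≢r (H3 a) (sym e)
  W-nbrs-distinct (n35 {a}) n34 ne = λ e → Nbhd.q≢r (H3 a) (sym e)
  W-nbrs-distinct (n35 {a}) n35 ne = ⊥-elim (ne (refl , refl))
  W-nbrs-distinct (n42 {a}) n42 ne = ⊥-elim (ne (refl , refl))
  W-nbrs-distinct (n42 {a}) n43 ne = Nbhd.p≢q (H4 a)
  W-nbrs-distinct (n42 {a}) n45 ne = Nbhd.p≢r (H4 a)
  W-nbrs-distinct (n43 {a}) n42 ne = λ e → Nbhd.p≢q (H4 a) (sym e)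
  W-nbrs-distinct (n43 {a}) n43 ne = ⊥-elim (ne (refl , refl))
  W-nbrs-distinct (n43 {a}) n45 ne = Nbhd.q≢r (H4 a)
  W-nbrs-distinct (n45 {a}) n42 ne = λ e → Nbhd.p≢r (H4 a) (sym e)
  W-nbrs-distinct (n45 {a}) n43 ne = λ e → Nbhd.q≢r (H4 a) (sym e)
  W-nbrs-distinct (n45 {a}) n45 ne = ⊥-elim (ne (refl , refl))
  W-nbrs-distinct (n53 {a}) n53 ne = ⊥-elim (ne (refl , refl))
  W-nbrs-distinct (n53 {a}) n54 ne = Nbhd.p≢q (H5 a)
  W-nbrs-distinct (n53 {a}) n50 ne = Nbhd.p≢r (H5 a)
  W-nbrs-distinct (n54 {a}) n53 ne = λ e → Nbhd.p≢q (H5 a) (sym e)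
  W-nbrs-distinct (n54 {a}) n54 ne = ⊥-elim (ne (refl , refl))
  W-nbrs-distinct (n54 {a}) n50 ne = Nbhd.q≢r (H5 a)
  W-nbrs-distinct (n50 {a}) n53 ne = λ e → Nbhd.p≢r (H5 a) (sym e)
  W-nbrs-distinct (n50 {a}) n54 ne = λ e → Nbhd.q≢r (H5 a) (sym e)
  W-nbrs-distinct (n50 {a}) n50 ne = ⊥-elim (ne (refl , refl))


  W-nbrs-only : ∀ {a r v} → A (W a r) v → ¬ (a ≡ 0 × r ≡ p0) → Σ ℕ λ b → Σ (Fin 6) λ s → Edge∞ a r b s × W b s ≡ v
  W-nbrs-only {zero} {p0} av nz = ⊥-elim (nz (refl , refl))
  W-nbrs-only {suc a} {p0} {v} av nz with Nbhd.only (H0 a) v av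
  ... | inj₁ e = _ , _ , n01 , sym e
  ... | inj₂ (inj₁ e) = _ , _ , n02 , sym e
  ... | inj₂ (inj₂ e) = _ , _ , n05 , sym e
  W-nbrs-only {a} {p1} {v} av nz with Nbhd.only (H1 a) v av
  ... | inj₁ e = _ , _ , n10 , sym e
  ... | inj₂ (inj₁ e) = _ , _ , n12 , sym e
  ... | inj₂ (inj₂ e) = _ , _ , n13 , sym e
  W-nbrs-only {a} {p2} {v} av nz with Nbhd.only (H2 a) v av
  ... | inj₁ e = _ , _ , n20 , sym e
  ... | inj₂ (inj₁ e) = _ , _ , n21 , sym e
  ... | inj₂ (inj₂ e) = _ , _ , n24 , sym e
  W-nbrs-only {a} {p3} {v} av nz with Nbhd.only (H3 a) v av
  ... | inj₁ e = _ , _ , n31 , sym e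
  ... | inj₂ (inj₁ e) = _ , _ , n34 , sym e
  ... | inj₂ (inj₂ e) = _ , _ , n35 , sym e
  W-nbrs-only {a} {p4} {v} av nz with Nbhd.only (H4 a) v av
  ... | inj₁ e = _ , _ , n42 , sym e
  ... | inj₂ (inj₁ e) = _ , _ , n43 , sym e
  ... | inj₂ (inj₂ e) = _ , _ , n45 , sym e
  W-nbrs-only {a} {p5} {v} av nz with Nbhd.only (H5 a) v av
  ... | inj₁ e = _ , _ , n53 , sym e
  ... | inj₂ (inj₁ e) = _ , _ , n54 , sym e
  ... | inj₂ (inj₂ e) = _ , _ , n50 , sym e

  Wᵢ : ℕ → V
  Wᵢ i = W (proj₁ (position i)) (proj₂ (position i))

  Wᵢ-index : ∀ a r → Wᵢ (index a r) ≡ W a r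
  Wᵢ-index a r rewrite position-index a r = refl

  Repeats : ℕ → Set
  Repeats m = Σ (Fin m) λ k → Wᵢ (toℕ k) ≡ Wᵢ m

  repeats? : ∀ m → Dec (Repeats m)
  repeats? m = any? (λ k → Wᵢ (toℕ k) ≟ Wᵢ m)

  someRepeat : Σ ℕ Repeats
  someRepeat with pigeonhole (n<1+n (order G)) (λ i → Wᵢ (toℕ i))
  ... | i , j , i<j , e = toℕ j , fromℕ< i<j , subst (λ z → Wᵢ z ≡ Wᵢ (toℕ j)) (sym (toℕ-fromℕ< i<j)) e

  firstRepeat : Σ ℕ λ m → Repeats m × (∀ k → k < m → ¬ Repeats k)
  firstRepeat = leastWitness repeats? (proj₁ someRepeat) (proj₂ someRepeat)
  m₀ : ℕ
  m₀ = proj₁ firstRepeat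
  m₀-repeats : Repeats m₀
  m₀-repeats = proj₁ (proj₂ firstRepeat)
  minimal : ∀ k → k < m₀ → ¬ Repeats k
  minimal = proj₂ (proj₂ firstRepeat)

  Wᵢ-injective : ∀ {i j} → i < m₀ → j < m₀ → Wᵢ i ≡ Wᵢ j → i ≡ j
  Wᵢ-injective {i} {j} li lj e with <-cmp i j
  ... | tri≈ _ q _ = q
  ... | tri< i<j _ _ = ⊥-elim (minimal j lj (fromℕ< i<j , subst (λ z → Wᵢ z ≡ Wᵢ j) (sym (toℕ-fromℕ< i<j)) e))
  ... | tri> _ _ j<i = ⊥-elim (minimal i li (fromℕ< j<i , subst (λ z → Wᵢ z ≡ Wᵢ i) (sym (toℕ-fromℕ< j<i)) (sym e)))

  W-injective : ∀ {a r b s} → index a r < m₀ → index b s < m₀ → W a r ≡ W b s → a ≡ b × r ≡ s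
  W-injective {a} {r} {b} {s} l1 l2 e = index-injective (Wᵢ-injective l1 l2 (trans (Wᵢ-index a r) (trans e (sym (Wᵢ-index b s)))))

  -- If (b , s) is not the start, a ladder neighbour of (a , r) of smaller index is also
  -- a neighbour of (b , s); comparing its index with m₀ contradicts minimality,
  -- irreflexivity or the distinctness of neighbours.
  nonstart-not-repeated : ∀ {a r b s} → index a r ≡ m₀ → index b s < m₀ → W b s ≡ W a r → ¬ (b ≡ 0 × s ≡ p0) → ⊥
  nonstart-not-repeated {a} {r} {b} {s} em lt eq b≢start = viaEarlierNbr (Edge∞-earlier a r a≢start)
    where
      a≢start : ¬ (a ≡ 0 × r ≡ p0)
      a≢start (refl , refl) with subst (index b s <_) (sym em) lt
      ... | ()
      b≢a : ¬ (b ≡ a × s ≡ r)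
      b≢a (refl , refl) = <-irrefl em lt
      viaEarlierNbr : (Σ ℕ λ b → Σ (Fin 6) λ s → Edge∞ a r b s × index b s < index a r) → ⊥
      viaEarlierNbr (a′ , r′ , a∼a′ , a′<a) with W-nbrs-only (subst (λ w → A w (W a′ r′)) (sym eq) (W-adj a∼a′)) b≢start
      ... | c , t , b∼c , Wc≡Wa′ with index c t <? m₀
      ... | yes c<m₀ with W-injective c<m₀ (subst (index a′ r′ <_) em a′<a) Wc≡Wa′
      ...   | refl , refl = W-nbrs-distinct (Edge∞-sym b∼c) (Edge∞-sym a∼a′) b≢a eq
      viaEarlierNbr (a′ , r′ , a∼a′ , a′<a) | c , t , b∼c , Wc≡Wa′ | no c≮m₀ with index c t ℕ.≟ m₀
      ... | yes c≡m₀ with index-injective {c} {t} {a} {r} (trans c≡m₀ (sym em))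
      ...   | refl , refl = A⇒≢ (W-adj a∼a′) Wc≡Wa′
      viaEarlierNbr (a′ , r′ , a∼a′ , a′<a) | c , t , b∼c , Wc≡Wa′ | no c≮m₀ | no c≢m₀ with Edge∞-consecutive {a} {r} b∼c e3 e4
        where
          m₀<c : m₀ < index c t
          m₀<c = ≤∧≢⇒< (≮⇒≥ c≮m₀) (λ e → c≢m₀ (sym e))
          m₀≡ : m₀ ≡ suc (index b s)
          m₀≡ = ≤-antisym (s≤s⁻¹ (≤-trans m₀<c (Edge∞-gap b∼c))) lt
          e3 : index c t ≡ 2 + index b s
          e3 = ≤-antisym (Edge∞-gap b∼c) (subst (λ z → suc z ≤ index c t) m₀≡ m₀<c)
          e4 : index a r ≡ 1 + index b s
          e4 = trans em m₀≡
      ... | inj₁ b∼a = A⇒≢ (W-adj b∼a) eq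
      ... | inj₂ a∼c = W-nbrs-distinct a∼a′ a∼c a′≢c (sym Wc≡Wa′)
        where
          a′≢c : ¬ (a′ ≡ c × r′ ≡ t)
          a′≢c (refl , refl) = <-irrefl refl (<-trans (subst (index a′ r′ <_) em a′<a) (≤∧≢⇒< (≮⇒≥ c≮m₀) (λ e → c≢m₀ (sym e))))

  ≤6⇒≤index-suc : ∀ {n} → n ≤ 6 → ∀ k r → n ≤ index (suc k) r
  ≤6⇒≤index-suc p k r = ≤-trans p (≤-trans (m≤m+n 6 (six k)) (m≤n+m (6 + six k) (toℕ r)))

  index-0<index-suc : ∀ t k r → index 0 t < index (suc k) r
  index-0<index-suc t k r = subst (λ z → suc z ≤ index (suc k) r) (sym (+-identityʳ (toℕ t))) (≤6⇒≤index-suc (toℕ<n t) k r)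

  start-nbr≡o : ∀ {a r c t} → index a r ≡ m₀ → 3 ≤ m₀ → W 0 p0 ≡ W a r → Edge∞ a r c t → index c t < m₀ → W c t ≡ o
  start-nbr≡o {a} {r} {c} {t} em m3 eq nb lt with Nbhd.only H00 (W c t) (subst (λ w → A w (W c t)) (sym eq) (W-adj nb))
  ... | inj₂ (inj₂ e) = e
  ... | inj₁ e with W-injective lt (≤-trans (s≤s (s≤s z≤n)) m3) e
  ...   | refl , refl = ⊥-elim (W-nbrs-distinct n10 (Edge∞-sym nb) ne eq)
    where
      ne : ¬ (0 ≡ a × p0 ≡ r)
      ne (refl , refl) with subst (3 ≤_) (sym em) m3
      ... | ()
  start-nbr≡o {a} {r} {c} {t} em m3 eq nb lt | inj₂ (inj₁ e) with W-injective lt m3 e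
  ...   | refl , refl = ⊥-elim (W-nbrs-distinct n20 (Edge∞-sym nb) ne eq)
    where
      ne : ¬ (0 ≡ a × p0 ≡ r)
      ne (refl , refl) with subst (3 ≤_) (sym em) m3
      ... | ()

  earlierNbrs-not-start : ∀ {a r b s c t} → index a r ≡ m₀ → 3 ≤ m₀ → W 0 p0 ≡ W a r →
    Edge∞ a r b s → Edge∞ a r c t → ¬ (b ≡ c × s ≡ t) → index b s < index a r → index c t < index a r → ⊥
  earlierNbrs-not-start em m₀≥3 eq ab ac b≠c b< c< =
    W-nbrs-distinct ab ac b≠c (trans (start-nbr≡o em m₀≥3 eq ab (subst (_ <_) em b<))
                                     (sym (start-nbr≡o em m₀≥3 eq ac (subst (_ <_) em c<))))

  start-at-y′⇒x′≡o : ∀ {k} → index (suc k) p1 ≡ m₀ → W 0 p0 ≡ W (suc k) p1 → W (suc k) p0 ≡ o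
  start-at-y′⇒x′≡o {k} em eq =
    start-nbr≡o em (subst (3 ≤_) em (≤6⇒≤index-suc (m≤n+m _ 3) k p1)) eq n10
                (subst (index (suc k) p0 <_) em (m≤n+m _ 0))

  start-not-at-y′ : ∀ {k} → index (suc k) p1 ≡ m₀ → W 0 p0 ≡ W (suc k) p1 → ⊥
  start-not-at-y′ {k} em eq
    with Nbhd.only H00 (W (suc k) p2) (subst (λ w → A w (W (suc k) p2)) (sym eq) (W-adj n12))
  ... | inj₂ (inj₂ e) = W-nbrs-distinct n10 n12 (λ { (_ , ()) }) (trans (start-at-y′⇒x′≡o em eq) (sym e))
  ... | inj₁ e with Nbhd.only (H1 0) o (A-sym (subst₂ A (start-at-y′⇒x′≡o em eq) e (W-adj n02)))
  ...   | inj₁ e′        = A⇒≢ (Nbhd.∼r H00) (sym e′)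
  ...   | inj₂ (inj₁ e′) = Nbhd.q≢r H00 (sym e′)
  ...   | inj₂ (inj₂ e′)
    with W-injective (subst (index (suc k) p0 <_) em (m≤n+m _ 0)) (subst (index 0 p3 <_) em (index-0<index-suc p3 k p1))
                     (trans (start-at-y′⇒x′≡o em eq) e′)
  ...     | _ , ()
  start-not-at-y′ {k} em eq | inj₂ (inj₁ e) with Nbhd.only (H2 0) o (A-sym (subst₂ A (start-at-y′⇒x′≡o em eq) e (W-adj n02)))
  ...   | inj₁ e′        = A⇒≢ (Nbhd.∼r H00) (sym e′)
  ...   | inj₂ (inj₁ e′) = Nbhd.p≢r H00 (sym e′)
  ...   | inj₂ (inj₂ e′)
    with W-injective (subst (index (suc k) p0 <_) em (m≤n+m _ 0)) (subst (index 0 p4 <_) em (index-0<index-suc p4 k p1))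
                     (trans (start-at-y′⇒x′≡o em eq) e′)
  ...     | _ , ()

  W-z′≢W-block₀ : ∀ {k t} → index (suc k) p3 ≡ m₀ → W (suc k) p2 ≢ W 0 t
  W-z′≢W-block₀ {k} {t} em e with W-injective (subst (index (suc k) p2 <_) em (m≤n+m _ 0)) (subst (index 0 t <_) em (index-0<index-suc t k p3)) e
  ... | () , _

  start-not-at-y : ∀ {k} → index (suc k) p3 ≡ m₀ → W 0 p0 ≡ W (suc k) p3 → ⊥
  start-not-at-y {k} em eq
    with Nbhd.only H00 (W (suc k) p4) (subst (λ w → A w (W (suc k) p4)) (sym eq) (W-adj n34))
  ... | inj₂ (inj₂ e) = W-nbrs-distinct n31 n34 (λ { (_ , ()) }) (trans y′≡o (sym e))
    where
      y′≡o = start-nbr≡o em (subst (3 ≤_) em (≤6⇒≤index-suc (m≤n+m _ 3) k p3)) eq n31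
                         (subst (index (suc k) p1 <_) em (m≤n+m _ 1))
  ... | inj₁ e        = [ W-z′≢W-block₀ em , [ W-z′≢W-block₀ em , W-z′≢W-block₀ em ] ]
                          (Nbhd.only (H1 0) (W (suc k) p2) (subst (λ w → A w (W (suc k) p2)) e (W-adj n42)))
  ... | inj₂ (inj₁ e) = [ W-z′≢W-block₀ em , [ W-z′≢W-block₀ em , W-z′≢W-block₀ em ] ]
                          (Nbhd.only (H2 0) (W (suc k) p2) (subst (λ w → A w (W (suc k) p2)) e (W-adj n42)))

  -- Any other position neighbours the start, or has earlier neighbours that would have
  -- to be the outer neighbour o of the start.
  start-repeated-at-block : ∀ {a r} → index a r ≡ m₀ → 0 < m₀ → W 0 p0 ≡ W a r → Σ ℕ λ k → a ≡ suc k × r ≡ p0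
  start-repeated-at-block {zero}  {p0} em pos eq = ⊥-elim (<-irrefl em pos)
  start-repeated-at-block {suc k} {p0} em pos eq = k , refl , refl
  start-repeated-at-block {zero}  {p1} em pos eq = ⊥-elim (A⇒≢ (W-adj n01) eq)
  start-repeated-at-block {zero}  {p2} em pos eq = ⊥-elim (A⇒≢ (W-adj n02) eq)
  start-repeated-at-block {zero}  {p3} em pos eq =
    ⊥-elim (Nbhd.p≢r H00 (start-nbr≡o em (subst (3 ≤_) em ≤-refl) eq n31 (subst (1 <_) em (m≤n+m _ 1))))
  start-repeated-at-block {zero}  {p4} em pos eq =
    ⊥-elim (earlierNbrs-not-start em (subst (3 ≤_) em (m≤n+m _ 1)) eq n42 n43 (λ { (_ , ()) }) (m≤n+m _ 1) (m≤n+m _ 0))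
  start-repeated-at-block {zero}  {p5} em pos eq =
    ⊥-elim (earlierNbrs-not-start em (subst (3 ≤_) em (m≤n+m _ 2)) eq n53 n54 (λ { (_ , ()) }) (m≤n+m _ 1) (m≤n+m _ 0))
  start-repeated-at-block {suc k} {p1} em pos eq = ⊥-elim (start-not-at-y′ em eq)
  start-repeated-at-block {suc k} {p2} em pos eq =
    ⊥-elim (earlierNbrs-not-start em (subst (3 ≤_) em (≤6⇒≤index-suc (m≤n+m _ 3) k p2)) eq n20 n21 (λ { (_ , ()) }) (m≤n+m _ 1) (m≤n+m _ 0))
  start-repeated-at-block {suc k} {p3} em pos eq = ⊥-elim (start-not-at-y em eq)
  start-repeated-at-block {suc k} {p4} em pos eq =
    ⊥-elim (earlierNbrs-not-start em (subst (3 ≤_) em (≤6⇒≤index-suc (m≤n+m _ 3) k p4)) eq n42 n43 (λ { (_ , ()) }) (m≤n+m _ 1) (m≤n+m _ 0))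
  start-repeated-at-block {suc k} {p5} em pos eq =
    ⊥-elim (earlierNbrs-not-start em (subst (3 ≤_) em (≤6⇒≤index-suc (m≤n+m _ 3) k p5)) eq n53 n54 (λ { (_ , ()) }) (m≤n+m _ 1) (m≤n+m _ 0))

  repeat-of-start : ∀ {a r b s} → index a r ≡ m₀ → index b s < m₀ → W b s ≡ W a r → b ≡ 0 × s ≡ p0
  repeat-of-start {b = b} {s} em lt eq with b ℕ.≟ 0 | s ≟ p0
  ... | yes refl | yes refl = refl , refl
  ... | no b≢0   | _        = ⊥-elim (nonstart-not-repeated em lt eq λ (e , _) → b≢0 e)
  ... | yes _    | no s≢p0  = ⊥-elim (nonstart-not-repeated em lt eq λ (_ , e) → s≢p0 e)

  closes : Σ ℕ λ k → W (suc k) p0 ≡ W 0 p0 ×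
            (∀ {a r b s} → index a r < six (suc k) → index b s < six (suc k) → W a r ≡ W b s → a ≡ b × r ≡ s)
  closes = fromRepeat (index-position m₀) (index-position (toℕ j)) (proj₂ m₀-repeats)
    where
      j : Fin m₀
      j = proj₁ m₀-repeats
      fromRepeat : ∀ {a r b s} → index a r ≡ m₀ → index b s ≡ toℕ j → W b s ≡ W a r →
                   Σ ℕ λ k → W (suc k) p0 ≡ W 0 p0 ×
                     (∀ {a r b s} → index a r < six (suc k) → index b s < six (suc k) → W a r ≡ W b s → a ≡ b × r ≡ s)
      fromRepeat em ej eq with repeat-of-start em (subst (_< m₀) (sym ej) (toℕ<n j)) eq
      ... | refl , refl with start-repeated-at-block em (≤-<-trans z≤n (toℕ<n j)) eq
      ...   | k , refl , refl =
        k , sym eq , λ {a} {r} {b} {s} l₁ l₂ → W-injective (subst (index a r <_) em l₁) (subst (index b s <_) em l₂)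

module Assembly (G : Graph) (simple : IsSimple G) (cubic : Cubic G)
  (connected : ∀ u v → Reachable G u v) (nonempty : 0 < order G)
  (strongTriangleAt : ∀ v → Σ (Fin (order G)) λ a → Σ (Fin (order G)) λ b →
                       CubicGraph.StrongTriangle G simple cubic v a b) where
  open Ladder G simple cubic strongTriangleAt

  opaque
    walk : ℕ → Σ V Port
    walk zero    = somePort (fromℕ< nonempty)
    walk (suc a) = nextBlock (walk a)

    unit : (a : ℕ) → Unit (proj₁ (walk a))
    unit a = completeUnit (proj₂ (walk a))

    W : ℕ → Fin 6 → V
    W a = lookup (proj₁ (walk a) ∷ Unit.y′ (unit a) ∷ Unit.z′ (unit a) ∷ Unit.y (unit a) ∷ Unit.z (unit a) ∷ Unit.x (unit a) ∷ [])

    o : V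
    o = Unit.o (unit 0)

    H00 : Nbhd A (W 0 p0) (W 0 p1) (W 0 p2) o
    H00 = Unit.Nq (unit 0)
    H0 : ∀ a → Nbhd A (W (suc a) p0) (W (suc a) p1) (W (suc a) p2) (W a p5)
    H0 a = subst (Nbhd A (W (suc a) p0) (W (suc a) p1) (W (suc a) p2)) (proj₂ (nextPort (unit a))) (Unit.Nq (unit (suc a)))
    H1 : ∀ a → Nbhd A (W a p1) (W a p0) (W a p2) (W a p3)
    H1 a = Unit.Ny′ (unit a)
    H2 : ∀ a → Nbhd A (W a p2) (W a p0) (W a p1) (W a p4)
    H2 a = Unit.Nz′ (unit a)
    H3 : ∀ a → Nbhd A (W a p3) (W a p1) (W a p4) (W a p5)
    H3 a = Unit.Ny (unit a)
    H4 : ∀ a → Nbhd A (W a p4) (W a p2) (W a p3) (W a p5)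
    H4 a = Unit.Nz (unit a)
    H5 : ∀ a → Nbhd A (W a p5) (W a p3) (W a p4) (W (suc a) p0)
    H5 a = Unit.Nx (unit a)

  open Closing G simple W o H00 H0 H1 H2 H3 H4 H5 using (closes)

  opaque
    K : ℕ
    K = proj₁ closes
    W-closes : W (suc K) p0 ≡ W 0 p0
    W-closes = proj₁ (proj₂ closes)
    W-injective : ∀ {a r b s} → index a r < six (suc K) → index b s < six (suc K) → W a r ≡ W b s → a ≡ b × r ≡ s
    W-injective = proj₂ (proj₂ closes)

  n : ℕ
  n = suc K

  o≡W : o ≡ W K p5
  o≡W with Nbhd.only H00 (W K p5) (subst (λ w → A w (W K p5)) W-closes (Nbhd.∼r (H0 K)))
  ... | inj₁ e with W-injective {K} {p5} {0} {p1} ≤-refl (s≤s (s≤s z≤n)) e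
  ...   | _ , ()
  o≡W | inj₂ (inj₁ e) with W-injective {K} {p5} {0} {p2} ≤-refl (s≤s (s≤s (s≤s z≤n))) e
  ...   | _ , ()
  o≡W | inj₂ (inj₂ e) = sym e

  open FGraph K hiding (n)

  -- Position of a vertex of Fₙ within its block of the ladder.
  ladderPos : Fin 6 → Fin 6
  ladderPos = lookup (p5 ∷ p3 ∷ p4 ∷ p0 ∷ p1 ∷ p2 ∷ [])

  ladderPos-injective : ∀ {s t} → ladderPos s ≡ ladderPos t → s ≡ t
  ladderPos-injective {s} {t} e = trans (sym (inverse s)) (trans (cong back e) (inverse t))
    where
      back : Fin 6 → Fin 6
      back = lookup (X′ ∷ Y′ ∷ Z′ ∷ Y ∷ Z ∷ X ∷ [])
      inverse : ∀ t → back (ladderPos t) ≡ t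
      inverse X  = refl
      inverse Y  = refl
      inverse Z  = refl
      inverse X′ = refl
      inverse Y′ = refl
      inverse Z′ = refl

  g : Fin n → Fin 6 → V
  g i t = W (toℕ i) (ladderPos t)

  W-sucF : ∀ i → W (toℕ (sucF i)) p0 ≡ W (suc (toℕ i)) p0
  W-sucF i with sucF-cases i
  ... | inj₁ e        = cong (λ a → W a p0) e
  ... | inj₂ (e , e′) = trans (cong (λ j → W (toℕ j) p0) e′) (trans (sym W-closes) (cong (λ a → W (suc a) p0) (sym e)))

  Nbhd-cong : ∀ {v a b c a′ b′ c′} → a ≡ a′ → b ≡ b′ → c ≡ c′ → Nbhd A v a b c → Nbhd A v a′ b′ c′
  Nbhd-cong refl refl refl N = N

  g-nbhd : ∀ i t → Nbhd A (g i t) (g (proj₁ (M₁ i t)) (proj₂ (M₁ i t)))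
                               (g (proj₁ (M₂ i t)) (proj₂ (M₂ i t)))
                               (g (proj₁ (M₃ i t)) (proj₂ (M₃ i t)))
  g-nbhd i X  = Nbhd-cong refl refl (sym (W-sucF i)) (H5 (toℕ i))
  g-nbhd i Y  = H3 (toℕ i)
  g-nbhd i Z  = H4 (toℕ i)
  g-nbhd zero    X′ = Nbhd-cong refl refl (trans o≡W (cong (λ a → W a p5) (sym (toℕ-fromℕ K)))) H00
  g-nbhd (suc j) X′ = Nbhd-cong refl refl (cong (λ a → W a p5) (sym (toℕ-inject₁ j))) (H0 (toℕ j))
  g-nbhd i Y′ = H1 (toℕ i)
  g-nbhd i Z′ = H2 (toℕ i)

  f : Fin (n * 6) → V
  f u = g (proj₁ (block u)) (proj₂ (block u))

  f-combine : ∀ i t → f (combine i t) ≡ g i t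
  f-combine i t = cong (λ p → g (proj₁ p) (proj₂ p)) (remQuot-combine i t)

  f-injective : ∀ {u v} → f u ≡ f v → u ≡ v
  f-injective {u} {v} e
    with W-injective (index<six (proj₁ (block u)) (ladderPos (proj₂ (block u))))
                     (index<six (proj₁ (block v)) (ladderPos (proj₂ (block v)))) e
    where
      six-mono : ∀ {a b} → a ≤ b → six a ≤ six b
      six-mono z≤n      = z≤n
      six-mono (s≤s le) = s≤s (s≤s (s≤s (s≤s (s≤s (s≤s (six-mono le))))))
      index<six : ∀ (i : Fin n) t → index (toℕ i) t < six n
      index<six i t = ≤-trans (ℕ.+-monoˡ-< (six (toℕ i)) (toℕ<n t)) (six-mono (toℕ<n i))
  ... | e₁ , e₂ =
    trans (sym (combine-block u))
      (trans (cong₂ combine (toℕ-injective e₁) (ladderPos-injective e₂)) (combine-block v))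

  G≅Fn : G ≅ F n
  G≅Fn = ≅-from-neighbourhoods G (F n) connected neighbourTable f f-injective
    (λ u → Nbhd-cong (sym (f-combine _ _)) (sym (f-combine _ _)) (sym (f-combine _ _))
                     (g-nbhd (proj₁ (block u)) (proj₂ (block u))))
    (combine {n} {6} zero zero)

  inFamily : InFamily G
  inFamily = byLength K refl
    where
      byLength : ∀ k → k ≡ K → InFamily G
      byLength zero    e = inj₂ (inj₂ (inj₁ (≅-trans {G} {F 1} {C6bar} (subst (λ k → G ≅ F (suc k)) (sym e) G≅Fn) F1≅C6bar)))
      byLength (suc k) e = inj₂ (inj₂ (inj₂ (suc (suc k) , s≤s (s≤s z≤n) , subst (λ k → G ≅ F (suc k)) (sym e) G≅Fn)))

inFamily⇒localizable : ∀ G → InFamily G → Localizable G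
inFamily⇒localizable G (inj₁ φ)                              = localizable-pullback φ localizable-K33
inFamily⇒localizable G (inj₂ (inj₁ φ))                       = localizable-pullback φ localizable-K4
inFamily⇒localizable G (inj₂ (inj₂ (inj₁ φ)))                = localizable-pullback φ localizable-C6bar
inFamily⇒localizable G (inj₂ (inj₂ (inj₂ (suc k , _ , φ)))) = localizable-pullback φ (FGraph.localizable k)

everyVertexInStrongClique⇒inFamily : (G : Graph) → IsSimple G → Connected G → Cubic G →
  EveryVertexInStrongClique G → InFamily G
everyVertexInStrongClique⇒inFamily G simple (nonempty , connected) cubic every
  with ∀⊎ (λ v → atVertex v (every v))
  where
    open LocalStructure G simple cubic connected
    atVertex : ∀ v → (∃ λ C → IsStrongClique G C × v ∈ C) → (Σ V λ a → Σ V λ b → StrongTriangle v a b) ⊎ InFamily G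
    atVertex v (C , strong , v∈C) with strongClique-cases v C strong v∈C
    ... | inj₁ G≅K4         = inj₂ (inj₂ (inj₁ G≅K4))
    ... | inj₂ (inj₁ G≅K33) = inj₂ (inj₁ G≅K33)
    ... | inj₂ (inj₂ tri)   = inj₁ tri
... | inj₂ inFamily         = inFamily
... | inj₁ strongTriangleAt = Assembly.inFamily G simple cubic connected nonempty strongTriangleAt

theorem6p8 : (G : Graph) → IsSimple G → Connected G → Cubic G →
    (Localizable G ⇔ EveryVertexInStrongClique G) ×
    (EveryVertexInStrongClique G ⇔ InFamily G)
theorem6p8 G simple connected cubic =
  mk⇔ (localizable⇒everyVertexInStrongClique G) (inFamily⇒localizable G ∘ every⇒inFamily) ,
  mk⇔ every⇒inFamily (localizable⇒everyVertexInStrongClique G ∘ inFamily⇒localizable G)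
  where
    every⇒inFamily : EveryVertexInStrongClique G → InFamily G
    every⇒inFamily = everyVertexInStrongClique⇒inFamily G simple connected cubic
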